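{- Let $3<r<n$. Then $$\left|\mathcal{A}^-_n(1324,1423;213)\big|_2^r\right|=\left|\mathcal{A}_{r-1}(1324,1423;213)\big|_2^{r-1}\right|.$$
   Context: A permutation $\pi$ of $[n]=\{1,\dots,n\}$ is cyclic if it consists of a single $n$-cycle. Its one-line notation is $\pi_1\pi_2\cdots\pi_n$ with $\pi_i=\pi(i)$. Its standard cycle form is $(c_1,c_2,\dots,c_n)$ with $c_1=1$ and $c_{i+1}=\pi(c_i)$ for $1\le i<n$. A sequence $w_1\cdots w_n$ of distinct integers contains a pattern $\sigma=\sigma_1\cdots\sigma_k\in S_k$ if there are indices $i_1<\dots<i_k$ with $w_{i_s}>w_{i_t}$ iff $\sigma_s>\sigma_t$ for all $s<t$; otherwise it avoids $\sigma$. $\mathcal{A}_n(1324,1423;213)$ is the set of cyclic permutations of $[n]$ whose one-line notation avoids $1324$ and $1423$ and whose standard cycle form $c_1\cdots c_n$, read as a sequence, avoids $213$. For $2\le j\le n$, $\mathcal{A}_n(1324,1423;213)\big|_2^j$ is the set of its elements whose standard cycle form has $c_j=2$. For $4\le r\le n$, $\mathcal{A}^-_n(1324,1423;213)\big|_2^r$ is the set of elements of $\mathcal{A}_n(1324,1423;213)$ whose standard cycle form has $c_r=2$ and $c_{r-1}\neq n$. -}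

module Defs where

open import Data.Nat using (ℕ; zero; suc; _+_; _∸_; _<ᵇ_; _≡ᵇ_)
open import Data.Bool using (Bool; true; false; _∧_; _∨_; not; if_then_else_)
open import Data.List using (List; []; _∷_; map; concatMap; filter; length; upTo; zip)
open import Data.Bool.ListAction using (any; and)
open import Data.Product using (proj₁; proj₂)
open import Relation.Nullary.Decidable using (Dec; yes; no)
open import Data.Bool using (T)
open import Data.Bool.Properties using (T?)

-- Conventions: a permutation of [n] is represented by its one-line notation,
-- the list π₁ π₂ … πₙ of natural numbers (values in 1..n).

range : ℕ → List ℕ
range n = map suc (upTo n)

words : List ℕ → ℕ → List (List ℕ)
words as zero    = [] ∷ []
words as (suc k) = concatMap (λ a → map (a ∷_) (words as k)) as

elem : ℕ → List ℕ → Bool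
elem x xs = any (λ y → x ≡ᵇ y) xs

distinct : List ℕ → Bool
distinct []       = true
distinct (x ∷ xs) = not (elem x xs) ∧ distinct xs

perms : ℕ → List (List ℕ)
perms n = filter (λ w → T? (distinct w)) (words (range n) n)

-- π(i) for 1-indexed position i (0 if out of range)
app : List ℕ → ℕ → ℕ
app []       i             = 0
app (x ∷ xs) zero          = 0
app (x ∷ xs) (suc zero)    = x
app (x ∷ xs) (suc (suc i)) = app xs (suc i)

orbit : List ℕ → ℕ → ℕ → List ℕ
orbit π zero    x = []
orbit π (suc k) x = x ∷ orbit π k (app π x)

cycleForm : List ℕ → List ℕ
cycleForm π = orbit π (length π) 1

-- π is cyclic (a single n-cycle) iff 1, π(1), …, π^{n-1}(1) are pairwise distinct
isCyclic : List ℕ → Bool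
isCyclic π = distinct (cycleForm π)

subseqs : ℕ → List ℕ → List (List ℕ)
subseqs zero    _        = [] ∷ []
subseqs (suc k) []       = []
subseqs (suc k) (x ∷ xs) = map (x ∷_) (subseqs k xs) Data.List.++ subseqs (suc k) xs

_==_ : Bool → Bool → Bool
true  == b = b
false == b = not b

sameOrder : List ℕ → List ℕ → Bool
sameOrder []       []       = true
sameOrder (w ∷ ws) (s ∷ ss) =
  and (map (λ p → (proj₁ p <ᵇ w) == (proj₂ p <ᵇ s)) (zip ws ss))
  ∧ sameOrder ws ss
sameOrder _        _        = false

contains : List ℕ → List ℕ → Bool
contains w σ = any (λ u → sameOrder u σ) (subseqs (length σ) w)

avoids : List ℕ → List ℕ → Bool
avoids w σ = not (contains w σ)

inA : List ℕ → Bool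
inA π = isCyclic π
      ∧ avoids π (1 ∷ 3 ∷ 2 ∷ 4 ∷ [])
      ∧ avoids π (1 ∷ 4 ∷ 2 ∷ 3 ∷ [])
      ∧ avoids (cycleForm π) (2 ∷ 1 ∷ 3 ∷ [])

A : ℕ → List (List ℕ)
A n = filter (λ π → T? (inA π)) (perms n)

c : List ℕ → ℕ → ℕ
c π j = app (cycleForm π) j

A∣2 : ℕ → ℕ → List (List ℕ)
A∣2 n j = filter (λ π → T? (c π j ≡ᵇ 2)) (A n)

A⁻∣2 : ℕ → ℕ → List (List ℕ)
A⁻∣2 n r = filter (λ π → T? ((c π r ≡ᵇ 2) ∧ not (c π (r ∸ 1) ≡ᵇ n))) (A n)

{-# OPTIONS --safe #-}
-- Both sets are computed explicitly.  If the cycle form c of an element of A_n(1324,1423;213)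
-- has c_r = 2, avoiding 213 forces each of c_2, ..., c_{r-1} to exceed every entry after
-- position r, and since π(m) = 1 for m = c_n, avoiding 1324 and 1423 forbids a valley
-- π(y) < π(x), π(z) with m < x < y < z.  Together these pin the cycle form down to
--   (1, k, k+1, ..., n, k-1, k-2, ..., 3+l, 2, 3, 4, ..., 2+l),   k = 3 + l + dd,
-- where the tail 3, ..., 2+l has length l = n - r, and the condition c_{r-1} /= n says dd >= 1.
-- On the right-hand side l = 0 and dd >= 0 is free.  Conversely each such cycle form belongs to
-- an element of A, which its cycle form determines, so both sides have r - 3 elements.
module Submission where

open import Defs
open import Data.Nat
open import Data.Nat.Properties
open import Data.Bool using (true; false; T; _∧_; not)
open import Data.Bool.Properties using (T?; T-∧)
open import Data.Empty using (⊥; ⊥-elim)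
open import Data.List using (List; []; _∷_; _++_; map; concatMap; filter; length; upTo; applyUpTo)
open import Data.List.Properties using (length-map; length-upTo; length-++; length-applyUpTo; filter-notAll; ∷-injectiveˡ; ∷-injectiveʳ)
open import Data.List.Membership.Propositional using (_∈_; find)
open import Data.List.Membership.Propositional.Properties
open import Data.List.Membership.DecPropositional _≟_ using (_∈?_)
open import Data.List.Membership.Propositional.Properties.WithK using (unique∧set⇒bag)
open import Data.List.Relation.Binary.BagAndSetEquality using (∼bag⇒↭)
open import Data.List.Relation.Binary.Permutation.Propositional.Properties using (↭-length)
open import Data.List.Relation.Unary.Any using (here; there)
import Data.List.Relation.Unary.Any as Any
open import Data.List.Relation.Unary.Any.Properties using (any⁺; any⁻)
open import Data.List.Relation.Unary.All using (All; []; _∷_)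
import Data.List.Relation.Unary.All as All
import Data.List.Relation.Unary.All.Properties as All
open import Data.List.Relation.Unary.Unique.Propositional using (Unique; []; _∷_)
import Data.List.Relation.Unary.Unique.Propositional.Properties as Unique
open import Data.Nat.Tactic.RingSolver using (solve-∀)
open import Data.Product using (∃; _×_; _,_; proj₁; proj₂; uncurry)
open import Data.Sum using (_⊎_; inj₁; inj₂)
open import Function.Base using (_∘_)
open import Function.Bundles using (Equivalence; mk⇔)
open import Relation.Binary.Definitions using (Tri; tri<; tri≈; tri>)
open import Relation.Binary.PropositionalEquality
open import Relation.Nullary using (¬_; yes; no)
open import Relation.Nullary.Decidable using (¬?)

T-not : ∀ {b} → T (not b) → ¬ T b
T-not {true} () _

not-T : ∀ {b} → ¬ T b → T (not b)
not-T {false} _ = _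
not-T {true} ¬t = ¬t _

T-∧⁻ : ∀ a b → T (a ∧ b) → T a × T b
T-∧⁻ a b = Equivalence.to (T-∧ {a} {b})

T-∧⁺ : ∀ a b → T a → T b → T (a ∧ b)
T-∧⁺ a b ta tb = Equivalence.from (T-∧ {a} {b}) (ta , tb)

∈⇒elem : ∀ {x xs} → x ∈ xs → T (elem x xs)
∈⇒elem {x} x∈ = any⁺ (x ≡ᵇ_) (Any.map (≡⇒≡ᵇ x _) x∈)

elem⇒∈ : ∀ {x} xs → T (elem x xs) → x ∈ xs
elem⇒∈ {x} xs t = Any.map (≡ᵇ⇒≡ x _) (any⁻ (x ≡ᵇ_) xs t)

distinct⇒Unique : ∀ w → T (distinct w) → Unique w
distinct⇒Unique []       _ = []
distinct⇒Unique (x ∷ xs) t with T-∧⁻ (not (elem x xs)) (distinct xs) t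
... | x∉xs , d = All.tabulate (λ y∈xs x≡y → T-not x∉xs (∈⇒elem (subst (_∈ xs) (sym x≡y) y∈xs)))
               ∷ distinct⇒Unique xs d

Unique⇒distinct : ∀ w → Unique w → T (distinct w)
Unique⇒distinct []       _            = _
Unique⇒distinct (x ∷ xs) (x∉xs ∷ u) =
  T-∧⁺ (not (elem x xs)) (distinct xs) (not-T (λ t → All.lookup x∉xs (elem⇒∈ xs t) refl)) (Unique⇒distinct xs u)

contains⁺ : ∀ w σ {u} → u ∈ subseqs (length σ) w → T (sameOrder u σ) → T (contains w σ)
contains⁺ w σ u∈ t = any⁺ (λ v → sameOrder v σ) (Any.map (λ { refl → t }) u∈)

contains⁻ : ∀ w σ → T (contains w σ) → ∃ λ u → u ∈ subseqs (length σ) w × T (sameOrder u σ)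
contains⁻ w σ t = find (any⁻ (λ v → sameOrder v σ) (subseqs (length σ) w) t)

app-∈ : ∀ w i → i < length w → app w (suc i) ∈ w
app-∈ (x ∷ xs) zero    _         = here refl
app-∈ (x ∷ xs) (suc i) (s≤s i<) = there (app-∈ xs i i<)

∈⇒app : ∀ {x} w → x ∈ w → ∃ λ i → i < length w × app w (suc i) ≡ x
∈⇒app (y ∷ ys) (here refl) = 0 , s≤s z≤n , refl
∈⇒app (y ∷ ys) (there x∈) with ∈⇒app ys x∈
... | i , i< , eq = suc i , s≤s i< , eq

Unique⇒app-injective : ∀ w → Unique w → ∀ i j → i < length w → j < length w →
                        app w (suc i) ≡ app w (suc j) → i ≡ j
Unique⇒app-injective (x ∷ xs) u zero zero _ _ _ = refl
Unique⇒app-injective (x ∷ xs) (x∉ ∷ u) zero (suc j) _ (s≤s j<) eq = ⊥-elim (All.lookup x∉ (app-∈ xs j j<) eq)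
Unique⇒app-injective (x ∷ xs) (x∉ ∷ u) (suc i) zero (s≤s i<) _ eq = ⊥-elim (All.lookup x∉ (app-∈ xs i i<) (sym eq))
Unique⇒app-injective (x ∷ xs) (x∉ ∷ u) (suc i) (suc j) (s≤s i<) (s≤s j<) eq =
  cong suc (Unique⇒app-injective xs u i j i< j< eq)

app-injective⇒Unique : ∀ w → (∀ i j → i < length w → j < length w → app w (suc i) ≡ app w (suc j) → i ≡ j) →
                        Unique w
app-injective⇒Unique []       _   = []
app-injective⇒Unique (x ∷ xs) inj =
  All.tabulate x≢ ∷ app-injective⇒Unique xs (λ i j i< j< eq → suc-injective (inj (suc i) (suc j) (s≤s i<) (s≤s j<) eq))
  where
  x≢ : ∀ {y} → y ∈ xs → x ≢ y
  x≢ y∈ refl with ∈⇒app xs y∈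
  ... | j , j< , eq with inj 0 (suc j) (s≤s z≤n) (s≤s j<) (sym eq)
  ... | ()

app-ext : ∀ v w → length v ≡ length w → (∀ i → i < length w → app v (suc i) ≡ app w (suc i)) → v ≡ w
app-ext []      []      _  _  = refl
app-ext (x ∷ v) (y ∷ w) eq pt =
  cong₂ _∷_ (pt 0 (s≤s z≤n)) (app-ext v w (suc-injective eq) (λ i i< → pt (suc i) (s≤s i<)))

app-++ˡ : ∀ (xs ys : List ℕ) i → i < length xs → app (xs ++ ys) (suc i) ≡ app xs (suc i)
app-++ˡ (x ∷ xs) ys zero    _         = refl
app-++ˡ (x ∷ xs) ys (suc i) (s≤s i<) = app-++ˡ xs ys i i<

app-++ʳ : ∀ (xs ys : List ℕ) {i} j → j ≡ length xs + i → app (xs ++ ys) (suc j) ≡ app ys (suc i)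
app-++ʳ []       ys _ refl = refl
app-++ʳ (x ∷ xs) ys _ refl = app-++ʳ xs ys _ refl

length-range : ∀ n → length (range n) ≡ n
length-range n = trans (length-map suc (upTo n)) (length-upTo n)

∈-range⁻ : ∀ {x n} → x ∈ range n → 1 ≤ x × x ≤ n
∈-range⁻ x∈ with ∈-map⁻ suc x∈
... | y , y∈ , refl = s≤s z≤n , ∈-upTo⁻ y∈

∈-range⁺ : ∀ {x n} → 1 ≤ x → x ≤ n → x ∈ range n
∈-range⁺ {suc x} _ x≤n = ∈-map⁺ suc (∈-upTo⁺ x≤n)

Unique-range : ∀ n → Unique (range n)
Unique-range n = Unique.map⁺ suc-injective (Unique.upTo⁺ n)

∈-words⁻ : ∀ as k w → w ∈ words as k → length w ≡ k × All (_∈ as) w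
∈-words⁻ as zero    w (here refl) = refl , []
∈-words⁻ as (suc k) w w∈ with find (∈-concatMap⁻ (λ a → map (a ∷_) (words as k)) {xs = as} w∈)
... | a , a∈ , w∈′ with ∈-map⁻ (a ∷_) w∈′
... | v , v∈ , refl with ∈-words⁻ as k v v∈
... | len , all = cong suc len , a∈ ∷ all

∈-words⁺ : ∀ as k w → length w ≡ k → All (_∈ as) w → w ∈ words as k
∈-words⁺ as zero    []      _   _          = here refl
∈-words⁺ as (suc k) (x ∷ w) len (x∈ ∷ all) =
  ∈-concatMap⁺ (λ a → map (a ∷_) (words as k)) {xs = as}
    (Any.map (λ { refl → ∈-map⁺ (x ∷_) (∈-words⁺ as k w (suc-injective len) all) }) x∈)

Unique-words : ∀ as k → Unique as → Unique (words as k)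
Unique-words as zero    _ = [] ∷ []
Unique-words as (suc k) u = prefixes as u
  where
  ws = words as k
  prefixes : ∀ bs → Unique bs → Unique (concatMap (λ a → map (a ∷_) ws) bs)
  prefixes []       _          = []
  prefixes (b ∷ bs) (b∉ ∷ ubs) =
    Unique.++⁺ (Unique.map⁺ ∷-injectiveʳ (Unique-words as k u)) (prefixes bs ubs) disjoint
    where
    disjoint : ∀ {v} → ¬ (v ∈ map (b ∷_) ws × v ∈ concatMap (λ a → map (a ∷_) ws) bs)
    disjoint (v∈ , v∈′) with ∈-map⁻ (b ∷_) v∈ | find (∈-concatMap⁻ (λ a → map (a ∷_) ws) {xs = bs} v∈′)
    ... | _ , _ , refl | a , a∈ , v∈″ = All.lookup b∉ a∈ (∷-injectiveˡ (proj₂ (proj₂ (∈-map⁻ (a ∷_) v∈″))))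

Unique-⊆⇒length≤ : ∀ (xs ys : List ℕ) → Unique xs → (∀ {x} → x ∈ xs → x ∈ ys) → length xs ≤ length ys
Unique-⊆⇒length≤ []       ys _          _  = z≤n
Unique-⊆⇒length≤ (x ∷ xs) ys (x∉ ∷ u) xs⊆ =
  ≤-trans (s≤s (Unique-⊆⇒length≤ xs others u xs⊆others))
          (filter-notAll (λ y → ¬? (x ≟ y)) ys (Any.map (λ { refl x≢x → x≢x refl }) (xs⊆ (here refl))))
  where
  others = filter (λ y → ¬? (x ≟ y)) ys
  xs⊆others : ∀ {z} → z ∈ xs → z ∈ others
  xs⊆others z∈ = ∈-filter⁺ (λ y → ¬? (x ≟ y)) (xs⊆ (there z∈)) (All.lookup x∉ z∈)

Unique-⊆-length≥⇒⊇ : ∀ (xs ys : List ℕ) → Unique xs → (∀ {x} → x ∈ xs → x ∈ ys) →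
                     length ys ≤ length xs → ∀ {y} → y ∈ ys → y ∈ xs
Unique-⊆-length≥⇒⊇ xs ys u xs⊆ ys≤ {y} y∈ with y ∈? xs
... | yes y∈xs = y∈xs
... | no  y∉xs = ⊥-elim (<⇒≱ xs<ys ys≤)
  where
  others = filter (λ z → ¬? (y ≟ z)) ys
  xs⊆others : ∀ {z} → z ∈ xs → z ∈ others
  xs⊆others z∈ = ∈-filter⁺ (λ z → ¬? (y ≟ z)) (xs⊆ z∈) (λ { refl → y∉xs z∈ })
  xs<ys : length xs < length ys
  xs<ys = ≤-<-trans (Unique-⊆⇒length≤ xs others u xs⊆others)
                    (filter-notAll (λ z → ¬? (y ≟ z)) ys (Any.map (λ { refl y≢y → y≢y refl }) y∈))

subseqs-keep : ∀ k x xs {u} → u ∈ subseqs k xs → (x ∷ u) ∈ subseqs (suc k) (x ∷ xs)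
subseqs-keep k x xs u∈ = ∈-++⁺ˡ (∈-map⁺ (x ∷_) u∈)

subseqs-skip : ∀ k x xs {u} → u ∈ subseqs (suc k) xs → u ∈ subseqs (suc k) (x ∷ xs)
subseqs-skip k x xs u∈ = ∈-++⁺ʳ (map (x ∷_) (subseqs k xs)) u∈

∈-subseqs₁⁺ : ∀ w a → 1 ≤ a → a ≤ length w → (app w a ∷ []) ∈ subseqs 1 w
∈-subseqs₁⁺ (x ∷ w) 1             _ _         = subseqs-keep 0 x w (here refl)
∈-subseqs₁⁺ (x ∷ w) (suc (suc a)) _ (s≤s a≤) = subseqs-skip 0 x w (∈-subseqs₁⁺ w (suc a) (s≤s z≤n) a≤)

∈-subseqs₂⁺ : ∀ w a b → 1 ≤ a → a < b → b ≤ length w → (app w a ∷ app w b ∷ []) ∈ subseqs 2 w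
∈-subseqs₂⁺ (x ∷ w) 1 (suc (suc b)) _ _ (s≤s b≤) = subseqs-keep 1 x w (∈-subseqs₁⁺ w (suc b) (s≤s z≤n) b≤)
∈-subseqs₂⁺ (x ∷ w) (suc (suc a)) (suc (suc b)) _ (s≤s a<b) (s≤s b≤) =
  subseqs-skip 1 x w (∈-subseqs₂⁺ w (suc a) (suc b) (s≤s z≤n) a<b b≤)
∈-subseqs₂⁺ (x ∷ w) 1 1 _ (s≤s ()) _

∈-subseqs₃⁺ : ∀ w a b c → 1 ≤ a → a < b → b < c → c ≤ length w →
              (app w a ∷ app w b ∷ app w c ∷ []) ∈ subseqs 3 w
∈-subseqs₃⁺ (x ∷ w) 1 (suc (suc b)) (suc (suc c)) _ _ (s≤s b<c) (s≤s c≤) =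
  subseqs-keep 2 x w (∈-subseqs₂⁺ w (suc b) (suc c) (s≤s z≤n) b<c c≤)
∈-subseqs₃⁺ (x ∷ w) (suc (suc a)) (suc (suc b)) (suc (suc c)) _ (s≤s a<b) (s≤s b<c) (s≤s c≤) =
  subseqs-skip 2 x w (∈-subseqs₃⁺ w (suc a) (suc b) (suc c) (s≤s z≤n) a<b b<c c≤)
∈-subseqs₃⁺ (x ∷ w) 1 1 _ _ (s≤s ()) _ _

∈-subseqs₄⁺ : ∀ w a b c d → 1 ≤ a → a < b → b < c → c < d → d ≤ length w →
              (app w a ∷ app w b ∷ app w c ∷ app w d ∷ []) ∈ subseqs 4 w
∈-subseqs₄⁺ (x ∷ w) 1 (suc (suc b)) (suc (suc c)) (suc (suc d)) _ _ (s≤s b<c) (s≤s c<d) (s≤s d≤) =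
  subseqs-keep 3 x w (∈-subseqs₃⁺ w (suc b) (suc c) (suc d) (s≤s z≤n) b<c c<d d≤)
∈-subseqs₄⁺ (x ∷ w) (suc (suc a)) (suc (suc b)) (suc (suc c)) (suc (suc d)) _ (s≤s a<b) (s≤s b<c) (s≤s c<d) (s≤s d≤) =
  subseqs-skip 3 x w (∈-subseqs₄⁺ w (suc a) (suc b) (suc c) (suc d) (s≤s z≤n) a<b b<c c<d d≤)
∈-subseqs₄⁺ (x ∷ w) 1 1 _ _ _ (s≤s ()) _ _ _

∈-subseqs₁⁻ : ∀ w u → u ∈ subseqs 1 w → ∃ λ a → 1 ≤ a × a ≤ length w × u ≡ app w a ∷ []
∈-subseqs₁⁻ (x ∷ w) u u∈ with ∈-++⁻ (map (x ∷_) (subseqs 0 w)) u∈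
... | inj₁ (here refl) = 1 , s≤s z≤n , s≤s z≤n , refl
... | inj₂ u∈′ with ∈-subseqs₁⁻ w u u∈′
...   | suc a , _ , a≤ , refl = suc (suc a) , s≤s z≤n , s≤s a≤ , refl

∈-subseqs₂⁻ : ∀ w u → u ∈ subseqs 2 w →
              ∃ λ a → ∃ λ b → 1 ≤ a × a < b × b ≤ length w × u ≡ app w a ∷ app w b ∷ []
∈-subseqs₂⁻ (x ∷ w) u u∈ with ∈-++⁻ (map (x ∷_) (subseqs 1 w)) u∈
... | inj₁ u∈′ with ∈-map⁻ (x ∷_) u∈′
...   | v , v∈ , refl with ∈-subseqs₁⁻ w v v∈
...     | suc b , _ , b≤ , refl = 1 , suc (suc b) , s≤s z≤n , s≤s (s≤s z≤n) , s≤s b≤ , refl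
∈-subseqs₂⁻ (x ∷ w) u u∈ | inj₂ u∈′ with ∈-subseqs₂⁻ w u u∈′
... | suc a , suc b , _ , s≤s a<b , b≤ , refl =
  suc (suc a) , suc (suc b) , s≤s z≤n , s≤s (s≤s a<b) , s≤s b≤ , refl

∈-subseqs₃⁻ : ∀ w u → u ∈ subseqs 3 w →
              ∃ λ a → ∃ λ b → ∃ λ c → 1 ≤ a × a < b × b < c × c ≤ length w ×
              u ≡ app w a ∷ app w b ∷ app w c ∷ []
∈-subseqs₃⁻ (x ∷ w) u u∈ with ∈-++⁻ (map (x ∷_) (subseqs 2 w)) u∈
... | inj₁ u∈′ with ∈-map⁻ (x ∷_) u∈′
...   | v , v∈ , refl with ∈-subseqs₂⁻ w v v∈
...     | suc b , suc c , _ , s≤s b<c , c≤ , refl =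
  1 , suc (suc b) , suc (suc c) , s≤s z≤n , s≤s (s≤s z≤n) , s≤s (s≤s b<c) , s≤s c≤ , refl
∈-subseqs₃⁻ (x ∷ w) u u∈ | inj₂ u∈′ with ∈-subseqs₃⁻ w u u∈′
... | suc a , suc b , suc c , _ , s≤s a<b , s≤s b<c , c≤ , refl =
  suc (suc a) , suc (suc b) , suc (suc c) , s≤s z≤n , s≤s (s≤s a<b) , s≤s (s≤s b<c) , s≤s c≤ , refl

∈-subseqs₄⁻ : ∀ w u → u ∈ subseqs 4 w →
              ∃ λ a → ∃ λ b → ∃ λ c → ∃ λ d → 1 ≤ a × a < b × b < c × c < d × d ≤ length w ×
              u ≡ app w a ∷ app w b ∷ app w c ∷ app w d ∷ []
∈-subseqs₄⁻ (x ∷ w) u u∈ with ∈-++⁻ (map (x ∷_) (subseqs 3 w)) u∈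
... | inj₁ u∈′ with ∈-map⁻ (x ∷_) u∈′
...   | v , v∈ , refl with ∈-subseqs₃⁻ w v v∈
...     | suc b , suc c , suc d , _ , s≤s b<c , s≤s c<d , d≤ , refl =
  1 , suc (suc b) , suc (suc c) , suc (suc d) , s≤s z≤n , s≤s (s≤s z≤n) , s≤s (s≤s b<c) , s≤s (s≤s c<d) , s≤s d≤ , refl
∈-subseqs₄⁻ (x ∷ w) u u∈ | inj₂ u∈′ with ∈-subseqs₄⁻ w u u∈′
... | suc a , suc b , suc c , suc d , _ , s≤s a<b , s≤s b<c , s≤s c<d , d≤ , refl =
  suc (suc a) , suc (suc b) , suc (suc c) , suc (suc d) ,
  s≤s z≤n , s≤s (s≤s a<b) , s≤s (s≤s b<c) , s≤s (s≤s c<d) , s≤s d≤ , refl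

<ᵇ-true : ∀ {m n} → m < n → (m <ᵇ n) ≡ true
<ᵇ-true {zero}  {suc n} _          = refl
<ᵇ-true {suc m} {suc n} (s≤s m<n) = <ᵇ-true m<n

<ᵇ-false : ∀ {m n} → n ≤ m → (m <ᵇ n) ≡ false
<ᵇ-false {m}     {zero}  _          = refl
<ᵇ-false {suc m} {suc n} (s≤s n≤m) = <ᵇ-false n≤m

<ᵇ-true⁻ : ∀ m n → (m <ᵇ n) ≡ true → m < n
<ᵇ-true⁻ m n eq = <ᵇ⇒< m n (subst T (sym eq) _)

<ᵇ-false⁻ : ∀ m n → (m <ᵇ n) ≡ false → n ≤ m
<ᵇ-false⁻ m n eq = ≮⇒≥ (λ m<n → subst T eq (<⇒<ᵇ m<n))

sameOrder-213⁺ : ∀ {a b c} → b < a → a < c → T (sameOrder (a ∷ b ∷ c ∷ []) (2 ∷ 1 ∷ 3 ∷ []))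
sameOrder-213⁺ b<a a<c rewrite <ᵇ-true b<a | <ᵇ-false (<⇒≤ a<c) | <ᵇ-false (<⇒≤ (<-trans b<a a<c)) = _

sameOrder-213⁻ : ∀ a b c → T (sameOrder (a ∷ b ∷ c ∷ []) (2 ∷ 1 ∷ 3 ∷ [])) → b < a × a ≤ c
sameOrder-213⁻ a b c _ with b <ᵇ a in b<a | c <ᵇ a in c≮a | c <ᵇ b
... | true | false | false = <ᵇ-true⁻ b a b<a , <ᵇ-false⁻ c a c≮a

sameOrder-1324⁺ : ∀ {a b c d} → a < c → c < b → b < d → T (sameOrder (a ∷ b ∷ c ∷ d ∷ []) (1 ∷ 3 ∷ 2 ∷ 4 ∷ []))
sameOrder-1324⁺ a<c c<b b<d
  rewrite <ᵇ-false (<⇒≤ (<-trans a<c c<b)) | <ᵇ-false (<⇒≤ a<c) | <ᵇ-false (<⇒≤ (<-trans (<-trans a<c c<b) b<d))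
        | <ᵇ-true c<b | <ᵇ-false (<⇒≤ b<d) | <ᵇ-false (<⇒≤ (<-trans c<b b<d)) = _

sameOrder-1423⁺ : ∀ {a b c d} → a < c → c < d → d < b → T (sameOrder (a ∷ b ∷ c ∷ d ∷ []) (1 ∷ 4 ∷ 2 ∷ 3 ∷ []))
sameOrder-1423⁺ a<c c<d d<b
  rewrite <ᵇ-false (<⇒≤ (<-trans (<-trans a<c c<d) d<b)) | <ᵇ-false (<⇒≤ a<c) | <ᵇ-false (<⇒≤ (<-trans a<c c<d))
        | <ᵇ-true (<-trans c<d d<b) | <ᵇ-true d<b | <ᵇ-false (<⇒≤ c<d) = _

sameOrder-1324⁻ : ∀ a b c d → T (sameOrder (a ∷ b ∷ c ∷ d ∷ []) (1 ∷ 3 ∷ 2 ∷ 4 ∷ [])) → a ≤ c × c < b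
sameOrder-1324⁻ a b c d _ with b <ᵇ a | c <ᵇ a in c≮a | d <ᵇ a | c <ᵇ b in c<b | d <ᵇ b | d <ᵇ c
... | false | false | false | true | false | false = <ᵇ-false⁻ c a c≮a , <ᵇ-true⁻ c b c<b

sameOrder-1423⁻ : ∀ a b c d → T (sameOrder (a ∷ b ∷ c ∷ d ∷ []) (1 ∷ 4 ∷ 2 ∷ 3 ∷ [])) → a ≤ c × c < b
sameOrder-1423⁻ a b c d _ with b <ᵇ a | c <ᵇ a in c≮a | d <ᵇ a | c <ᵇ b in c<b | d <ᵇ b | d <ᵇ c
... | false | false | false | true | true | false = <ᵇ-false⁻ c a c≮a , <ᵇ-true⁻ c b c<b

length-orbit : ∀ π k x → length (orbit π k x) ≡ k
length-orbit π zero    x = refl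
length-orbit π (suc k) x = cong suc (length-orbit π k (app π x))

app-orbit-1 : ∀ π k x → 0 < k → app (orbit π k x) 1 ≡ x
app-orbit-1 π (suc k) x _ = refl

app-orbit-suc : ∀ π k x i → suc i < k → app (orbit π k x) (suc (suc i)) ≡ app π (app (orbit π k x) (suc i))
app-orbit-suc π (suc (suc k)) x zero    _             = refl
app-orbit-suc π (suc k)       x (suc i) (s≤s si<k) = app-orbit-suc π k (app π x) i si<k

-- P and C are the one-line notation and the cycle form of an element of A_n(1324,1423;213),
-- both read as functions on the positions 1, ..., n.
record InA (n : ℕ) (P C : ℕ → ℕ) : Set where
  field
    C-1           : C 1 ≡ 1
    C-range       : ∀ i → 1 ≤ i → i ≤ n → 1 ≤ C i × C i ≤ n
    C-injective   : ∀ i j → 1 ≤ i → i ≤ n → 1 ≤ j → j ≤ n → C i ≡ C j → i ≡ j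
    C-surjective  : ∀ v → 1 ≤ v → v ≤ n → ∃ λ i → 1 ≤ i × i ≤ n × C i ≡ v
    P-step        : ∀ i → 1 ≤ i → i < n → P (C i) ≡ C (suc i)
    P-last        : P (C n) ≡ 1
    P-range       : ∀ x → 1 ≤ x → x ≤ n → 1 ≤ P x × P x ≤ n
    P-injective   : ∀ x y → 1 ≤ x → x ≤ n → 1 ≤ y → y ≤ n → P x ≡ P y → x ≡ y
    C-avoids-213  : ∀ a b c → 1 ≤ a → a < b → b < c → c ≤ n → C b < C a → C a < C c → ⊥
    P-avoids-1324 : ∀ a b c d → 1 ≤ a → a < b → b < c → c < d → d ≤ n →
                    P a < P c → P c < P b → P b < P d → ⊥
    P-avoids-1423 : ∀ a b c d → 1 ≤ a → a < b → b < c → c < d → d ≤ n →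
                    P a < P c → P c < P d → P d < P b → ⊥

∈perms⁻ : ∀ n {π} → π ∈ perms n → length π ≡ n × All (_∈ range n) π × Unique π
∈perms⁻ n {π} π∈ with ∈-filter⁻ (λ w → T? (distinct w)) {xs = words (range n) n} π∈
... | π∈words , d with ∈-words⁻ (range n) n π π∈words
... | len , all = len , all , distinct⇒Unique π d

∈perms⁺ : ∀ {n π} → length π ≡ n → All (_∈ range n) π → Unique π → π ∈ perms n
∈perms⁺ {n} {π} len all u =
  ∈-filter⁺ (λ w → T? (distinct w)) (∈-words⁺ (range n) n π len all) (Unique⇒distinct π u)

inA⁻ : ∀ π → T (inA π) → T (isCyclic π) × T (avoids π (1 ∷ 3 ∷ 2 ∷ 4 ∷ [])) ×
                         T (avoids π (1 ∷ 4 ∷ 2 ∷ 3 ∷ [])) × T (avoids (cycleForm π) (2 ∷ 1 ∷ 3 ∷ []))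
inA⁻ π t with T-∧⁻ (isCyclic π) _ t
... | cyc , t₁ with T-∧⁻ (avoids π (1 ∷ 3 ∷ 2 ∷ 4 ∷ [])) _ t₁
... | av₁ , t₂ with T-∧⁻ (avoids π (1 ∷ 4 ∷ 2 ∷ 3 ∷ [])) (avoids (cycleForm π) (2 ∷ 1 ∷ 3 ∷ [])) t₂
... | av₂ , av₃ = cyc , av₁ , av₂ , av₃

inA⁺ : ∀ π → T (isCyclic π) → T (avoids π (1 ∷ 3 ∷ 2 ∷ 4 ∷ [])) →
       T (avoids π (1 ∷ 4 ∷ 2 ∷ 3 ∷ [])) → T (avoids (cycleForm π) (2 ∷ 1 ∷ 3 ∷ [])) → T (inA π)
inA⁺ π cyc av₁ av₂ av₃ =
  T-∧⁺ (isCyclic π) _ cyc (T-∧⁺ (avoids π (1 ∷ 3 ∷ 2 ∷ 4 ∷ [])) _ av₁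
    (T-∧⁺ (avoids π (1 ∷ 4 ∷ 2 ∷ 3 ∷ [])) (avoids (cycleForm π) (2 ∷ 1 ∷ 3 ∷ [])) av₂ av₃))

∈A⁻ : ∀ n {π} → π ∈ A n → π ∈ perms n × T (inA π)
∈A⁻ n = ∈-filter⁻ (λ π → T? (inA π)) {xs = perms n}

length-∈A : ∀ n {π} → π ∈ A n → length π ≡ n
length-∈A n π∈ = proj₁ (∈perms⁻ n (proj₁ (∈A⁻ n π∈)))

∈A⇒InA : ∀ n π → 1 ≤ n → π ∈ A n → InA n (app π) (c π)
∈A⇒InA n π 1≤n π∈ = record
  { C-1 = C-1 ; C-range = C-range ; C-injective = C-injective ; C-surjective = C-surjective
  ; P-step = P-step ; P-last = P-last ; P-range = P-range ; P-injective = P-injective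
  ; C-avoids-213 = C-avoids-213 ; P-avoids-1324 = P-avoids-1324 ; P-avoids-1423 = P-avoids-1423 }
  where
  perm = ∈perms⁻ n (proj₁ (∈A⁻ n π∈))
  len : length π ≡ n
  len = proj₁ perm
  conds = inA⁻ π (proj₂ (∈A⁻ n π∈))
  cyclic = proj₁ conds
  avoid-1324 = proj₁ (proj₂ conds)
  avoid-1423 = proj₁ (proj₂ (proj₂ conds))
  avoid-213 = proj₂ (proj₂ (proj₂ conds))
  cf = cycleForm π
  len-cf : length cf ≡ n
  len-cf = trans (length-orbit π (length π) 1) len
  Unique-cf : Unique cf
  Unique-cf = distinct⇒Unique cf cyclic
  <len : ∀ {i} → i < n → i < length π
  <len {i} = subst (i <_) (sym len)
  <len-cf : ∀ {i} → i < n → i < length cf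
  <len-cf {i} = subst (i <_) (sym len-cf)

  C-1 : c π 1 ≡ 1
  C-1 = app-orbit-1 π (length π) 1 (<len 1≤n)
  P-range : ∀ x → 1 ≤ x → x ≤ n → 1 ≤ app π x × app π x ≤ n
  P-range (suc x) _ x<n = ∈-range⁻ (All.lookup (proj₁ (proj₂ perm)) (app-∈ π x (<len x<n)))
  P-step : ∀ i → 1 ≤ i → i < n → app π (c π i) ≡ c π (suc i)
  P-step (suc i) _ i<n = sym (app-orbit-suc π (length π) 1 i (<len i<n))
  C-range : ∀ i → 1 ≤ i → i ≤ n → 1 ≤ c π i × c π i ≤ n
  C-range 1 _ _ = subst (λ v → 1 ≤ v × v ≤ n) (sym C-1) (≤-refl , 1≤n)
  C-range (suc (suc i)) _ i<n with C-range (suc i) (s≤s z≤n) (<⇒≤ i<n)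
  ... | 1≤ , ≤n = subst (λ v → 1 ≤ v × v ≤ n) (P-step (suc i) (s≤s z≤n) i<n) (P-range _ 1≤ ≤n)
  C-injective : ∀ i j → 1 ≤ i → i ≤ n → 1 ≤ j → j ≤ n → c π i ≡ c π j → i ≡ j
  C-injective (suc i) (suc j) _ i<n _ j<n eq =
    cong suc (Unique⇒app-injective cf Unique-cf i j (<len-cf i<n) (<len-cf j<n) eq)
  P-injective : ∀ x y → 1 ≤ x → x ≤ n → 1 ≤ y → y ≤ n → app π x ≡ app π y → x ≡ y
  P-injective (suc x) (suc y) _ x<n _ y<n eq =
    cong suc (Unique⇒app-injective π (proj₂ (proj₂ perm)) x y (<len x<n) (<len y<n) eq)
  C-surjective : ∀ v → 1 ≤ v → v ≤ n → ∃ λ i → 1 ≤ i × i ≤ n × c π i ≡ v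
  C-surjective v 1≤v v≤n with ∈⇒app cf (Unique-⊆-length≥⇒⊇ cf (range n) Unique-cf cf⊆range
                                          (≤-reflexive (trans (length-range n) (sym len-cf))) (∈-range⁺ 1≤v v≤n))
    where
    cf⊆range : ∀ {x} → x ∈ cf → x ∈ range n
    cf⊆range x∈ with ∈⇒app cf x∈
    ... | i , i< , refl = uncurry ∈-range⁺ (C-range (suc i) (s≤s z≤n) (subst (i <_) len-cf i<))
  ... | i , i< , eq = suc i , s≤s z≤n , subst (i <_) len-cf i< , eq
  P-last : app π (c π n) ≡ 1
  P-last with C-range n 1≤n ≤-refl
  ... | 1≤ , ≤n with C-surjective (app π (c π n)) (proj₁ (P-range _ 1≤ ≤n)) (proj₂ (P-range _ 1≤ ≤n))
  ... | 1 , _ , _ , eq = trans (sym eq) C-1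
  ... | suc (suc i) , _ , i<n , eq = ⊥-elim (<⇒≢ i<n (sym (C-injective n (suc i) 1≤n ≤-refl (s≤s z≤n) (<⇒≤ i<n) Cn≡)))
    where
    Cn≡ : c π n ≡ c π (suc i)
    Cn≡ = P-injective _ _ 1≤ ≤n (proj₁ (C-range (suc i) (s≤s z≤n) (<⇒≤ i<n))) (proj₂ (C-range (suc i) (s≤s z≤n) (<⇒≤ i<n)))
            (trans (sym eq) (sym (P-step (suc i) (s≤s z≤n) i<n)))
  C-avoids-213 : ∀ a b c′ → 1 ≤ a → a < b → b < c′ → c′ ≤ n → c π b < c π a → c π a < c π c′ → ⊥
  C-avoids-213 a b c′ 1≤a a<b b<c c≤n ba ac = T-not avoid-213
    (contains⁺ cf (2 ∷ 1 ∷ 3 ∷ []) (∈-subseqs₃⁺ cf a b c′ 1≤a a<b b<c (subst (c′ ≤_) (sym len-cf) c≤n)) (sameOrder-213⁺ ba ac))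
  P-avoids-1324 : ∀ a b c′ d → 1 ≤ a → a < b → b < c′ → c′ < d → d ≤ n →
                  app π a < app π c′ → app π c′ < app π b → app π b < app π d → ⊥
  P-avoids-1324 a b c′ d 1≤a a<b b<c c<d d≤n ac cb bd = T-not avoid-1324
    (contains⁺ π (1 ∷ 3 ∷ 2 ∷ 4 ∷ []) (∈-subseqs₄⁺ π a b c′ d 1≤a a<b b<c c<d (subst (d ≤_) (sym len) d≤n)) (sameOrder-1324⁺ ac cb bd))
  P-avoids-1423 : ∀ a b c′ d → 1 ≤ a → a < b → b < c′ → c′ < d → d ≤ n →
                  app π a < app π c′ → app π c′ < app π d → app π d < app π b → ⊥
  P-avoids-1423 a b c′ d 1≤a a<b b<c c<d d≤n ac cd db = T-not avoid-1423
    (contains⁺ π (1 ∷ 4 ∷ 2 ∷ 3 ∷ []) (∈-subseqs₄⁺ π a b c′ d 1≤a a<b b<c c<d (subst (d ≤_) (sym len) d≤n)) (sameOrder-1423⁺ ac cd db))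

orbit-chain : ∀ π (cyc : List ℕ) → (∀ i → suc i < length cyc → app π (app cyc (suc i)) ≡ app cyc (suc (suc i))) →
              orbit π (length cyc) (app cyc 1) ≡ cyc
orbit-chain π []           _     = refl
orbit-chain π (x ∷ [])     _     = refl
orbit-chain π (x ∷ y ∷ ys) chain =
  cong (x ∷_) (trans (cong (orbit π (length (y ∷ ys))) (chain 0 (s≤s (s≤s z≤n))))
                     (orbit-chain π (y ∷ ys) (λ i si< → chain (suc i) (s≤s si<))))

module CycleList (n : ℕ) (π cyc : List ℕ) (1≤n : 1 ≤ n) (len-π : length π ≡ n) (len-cyc : length cyc ≡ n)
                 (unique-cyc : Unique cyc) (range-cyc : All (_∈ range n) cyc) (cyc-1 : app cyc 1 ≡ 1)
                 (chain : ∀ i → suc i < n → app π (app cyc (suc i)) ≡ app cyc (suc (suc i)))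
                 (close : app π (app cyc n) ≡ 1) where

  private
    cyc-onto : ∀ x → 1 ≤ x → x ≤ n → ∃ λ i → i < n × app cyc (suc i) ≡ x
    cyc-onto x 1≤x x≤n with ∈⇒app cyc (Unique-⊆-length≥⇒⊇ cyc (range n) unique-cyc (All.lookup range-cyc)
                                         (≤-reflexive (trans (length-range n) (sym len-cyc))) (∈-range⁺ 1≤x x≤n))
    ... | i , i< , eq = i , subst (i <_) len-cyc i< , eq

    cyc-injective : ∀ i j → i < n → j < n → app cyc (suc i) ≡ app cyc (suc j) → i ≡ j
    cyc-injective i j i<n j<n = Unique⇒app-injective cyc unique-cyc i j (subst (i <_) (sym len-cyc) i<n) (subst (j <_) (sym len-cyc) j<n)

    image : ∀ i → i < n → (suc i < n × app π (app cyc (suc i)) ≡ app cyc (suc (suc i)))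
                        ⊎ (suc i ≡ n × app π (app cyc (suc i)) ≡ app cyc 1)
    image i i<n with suc i ≟ n
    ... | yes refl = inj₂ (refl , trans close (sym cyc-1))
    ... | no  si≢n = inj₁ (≤∧≢⇒< i<n si≢n , chain i (≤∧≢⇒< i<n si≢n))

    image-range : ∀ i → i < n → app π (app cyc (suc i)) ∈ range n
    image-range i i<n with image i i<n
    ... | inj₁ (si<n , eq) = subst (_∈ range n) (sym eq) (All.lookup range-cyc (app-∈ cyc (suc i) (subst (suc i <_) (sym len-cyc) si<n)))
    ... | inj₂ (_ , eq) = subst (_∈ range n) (sym (trans eq cyc-1)) (∈-range⁺ ≤-refl 1≤n)

    image-injective : ∀ i j → i < n → j < n → app π (app cyc (suc i)) ≡ app π (app cyc (suc j)) → i ≡ j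
    image-injective i j i<n j<n eq with image i i<n | image j j<n
    ... | inj₁ (si< , ei) | inj₁ (sj< , ej) = suc-injective (cyc-injective (suc i) (suc j) si< sj< (trans (sym ei) (trans eq ej)))
    ... | inj₁ (si< , ei) | inj₂ (_ , ej) with cyc-injective (suc i) 0 si< 1≤n (trans (sym ei) (trans eq ej))
    ...   | ()
    image-injective i j i<n j<n eq | inj₂ (_ , ei) | inj₁ (sj< , ej) with cyc-injective 0 (suc j) 1≤n sj< (trans (sym ei) (trans eq ej))
    ...   | ()
    image-injective i j i<n j<n eq | inj₂ (si≡n , _) | inj₂ (sj≡n , _) = suc-injective (trans si≡n (sym sj≡n))

    range-π : All (_∈ range n) π
    range-π = All.tabulate λ y∈ → in-range (∈⇒app π y∈)
      where
      in-range : ∀ {y} → (∃ λ x → x < length π × app π (suc x) ≡ y) → y ∈ range n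
      in-range (x , x< , refl) with cyc-onto (suc x) (s≤s z≤n) (subst (x <_) len-π x<)
      ... | i , i<n , eq = subst (λ z → app π z ∈ range n) eq (image-range i i<n)

    unique-π : Unique π
    unique-π = app-injective⇒Unique π (λ x y x< y< → injective x y (subst (x <_) len-π x<) (subst (y <_) len-π y<))
      where
      injective : ∀ x y → x < n → y < n → app π (suc x) ≡ app π (suc y) → x ≡ y
      injective x y x<n y<n eq with cyc-onto (suc x) (s≤s z≤n) x<n | cyc-onto (suc y) (s≤s z≤n) y<n
      ... | i , i<n , ei | j , j<n , ej = suc-injective (trans (sym ei) (trans (cong (λ k → app cyc (suc k)) i≡j) ej))
        where
        i≡j : i ≡ j
        i≡j = image-injective i j i<n j<n (trans (cong (app π) ei) (trans eq (cong (app π) (sym ej))))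

  ∈perms : π ∈ perms n
  ∈perms = ∈perms⁺ len-π range-π unique-π

  cycleForm≡ : cycleForm π ≡ cyc
  cycleForm≡ = trans (cong₂ (orbit π) (trans len-π (sym len-cyc)) (sym cyc-1))
                     (orbit-chain π cyc (λ i si< → chain i (subst (suc i <_) len-cyc si<)))

Unique⇒app-<⇒≢ : ∀ w → Unique w → ∀ a b → 1 ≤ a → a < b → b ≤ length w → app w a ≢ app w b
Unique⇒app-<⇒≢ w u (suc a) (suc b) _ a<b b≤ eq =
  <⇒≢ a<b (cong suc (Unique⇒app-injective w u a b (<-trans (≤-pred a<b) b≤) b≤ eq))

avoids-213⁺ : ∀ w → Unique w →
              (∀ a b c → 1 ≤ a → a < b → b < c → c ≤ length w → app w b < app w a → app w a < app w c → ⊥) →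
              T (avoids w (2 ∷ 1 ∷ 3 ∷ []))
avoids-213⁺ w u no-213 = not-T λ t → occurrence (contains⁻ w (2 ∷ 1 ∷ 3 ∷ []) t)
  where
  occurrence : (∃ λ v → v ∈ subseqs 3 w × T (sameOrder v (2 ∷ 1 ∷ 3 ∷ []))) → ⊥
  occurrence (v , v∈ , so) with ∈-subseqs₃⁻ w v v∈
  ... | a , b , c , 1≤a , a<b , b<c , c≤ , refl with sameOrder-213⁻ _ _ _ so
  ... | ba , a≤c = no-213 a b c 1≤a a<b b<c c≤ ba (≤∧≢⇒< a≤c (Unique⇒app-<⇒≢ w u a c 1≤a (<-trans a<b b<c) c≤))

module _ (w : List ℕ) (u : Unique w)
         (no-132 : ∀ a b c → 1 ≤ a → a < b → b < c → c < length w → app w a < app w c → app w c < app w b → ⊥) where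

  private
    no-132-prefix : ∀ a b c d → 1 ≤ a → a < b → b < c → c < d → d ≤ length w →
                    app w a ≤ app w c → app w c < app w b → ⊥
    no-132-prefix a b c d 1≤a a<b b<c c<d d≤ a≤c cb =
      no-132 a b c 1≤a a<b b<c (<-≤-trans c<d d≤) (≤∧≢⇒< a≤c (Unique⇒app-<⇒≢ w u a c 1≤a (<-trans a<b b<c) (<⇒≤ (<-≤-trans c<d d≤)))) cb

  avoids-1324⁺ : T (avoids w (1 ∷ 3 ∷ 2 ∷ 4 ∷ []))
  avoids-1324⁺ = not-T λ t → occurrence (contains⁻ w (1 ∷ 3 ∷ 2 ∷ 4 ∷ []) t)
    where
    occurrence : (∃ λ v → v ∈ subseqs 4 w × T (sameOrder v (1 ∷ 3 ∷ 2 ∷ 4 ∷ []))) → ⊥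
    occurrence (v , v∈ , so) with ∈-subseqs₄⁻ w v v∈
    ... | a , b , c , d , 1≤a , a<b , b<c , c<d , d≤ , refl =
      uncurry (no-132-prefix a b c d 1≤a a<b b<c c<d d≤) (sameOrder-1324⁻ _ _ _ _ so)

  avoids-1423⁺ : T (avoids w (1 ∷ 4 ∷ 2 ∷ 3 ∷ []))
  avoids-1423⁺ = not-T λ t → occurrence (contains⁻ w (1 ∷ 4 ∷ 2 ∷ 3 ∷ []) t)
    where
    occurrence : (∃ λ v → v ∈ subseqs 4 w × T (sameOrder v (1 ∷ 4 ∷ 2 ∷ 3 ∷ []))) → ⊥
    occurrence (v , v∈ , so) with ∈-subseqs₄⁻ w v v∈
    ... | a , b , c , d , 1≤a , a<b , b<c , c<d , d≤ , refl =
      uncurry (no-132-prefix a b c d 1≤a a<b b<c c<d d≤) (sameOrder-1423⁻ _ _ _ _ so)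

Increasing : (ℕ → ℕ) → ℕ → Set
Increasing f d = ∀ t → t < d → f t < f (suc t)

module _ {f : ℕ → ℕ} {d : ℕ} (inc : Increasing f d) where

  Increasing-gap : ∀ s j → s + j ≤ d → f s + j ≤ f (s + j)
  Increasing-gap s zero    _  = ≤-reflexive (trans (+-identityʳ (f s)) (cong f (sym (+-identityʳ s))))
  Increasing-gap s (suc j) ≤d = begin
    f s + suc j     ≡⟨ +-suc (f s) j ⟩
    suc (f s + j)   ≤⟨ s≤s (Increasing-gap s j (≤-trans (+-monoʳ-≤ s (n≤1+n j)) ≤d)) ⟩
    suc (f (s + j)) ≤⟨ inc (s + j) (subst (_≤ d) (+-suc s j) ≤d) ⟩
    f (suc (s + j)) ≡⟨ cong f (sym (+-suc s j)) ⟩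
    f (s + suc j)   ∎
    where open ≤-Reasoning

  Increasing-lower : ∀ t → t ≤ d → f 0 + t ≤ f t
  Increasing-lower t = Increasing-gap 0 t

  Increasing-mono : ∀ s t → s ≤ t → t ≤ d → f s ≤ f t
  Increasing-mono s t s≤t t≤d with m≤n⇒∃[o]m+o≡n s≤t
  ... | j , refl = ≤-trans (m≤m+n (f s) j) (Increasing-gap s j t≤d)

  Increasing-squeeze : ∀ lo → lo ≤ f 0 → f d ≤ lo + d → ∀ t → t ≤ d → f t ≡ lo + t
  Increasing-squeeze lo lo≤ ≤lo+d t t≤d = ≤-antisym (+-cancelʳ-≤ (d ∸ t) (f t) (lo + t) upper) lower
    where
    lower : lo + t ≤ f t
    lower = ≤-trans (+-monoˡ-≤ t lo≤) (Increasing-lower t t≤d)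
    t+[d∸t] : t + (d ∸ t) ≡ d
    t+[d∸t] = m+[n∸m]≡n t≤d
    upper : f t + (d ∸ t) ≤ lo + t + (d ∸ t)
    upper = begin
      f t + (d ∸ t)      ≤⟨ Increasing-gap t (d ∸ t) (≤-reflexive t+[d∸t]) ⟩
      f (t + (d ∸ t))    ≡⟨ cong f t+[d∸t] ⟩
      f d                ≤⟨ ≤lo+d ⟩
      lo + d             ≡⟨ cong (lo +_) (sym t+[d∸t]) ⟩
      lo + (t + (d ∸ t)) ≡⟨ sym (+-assoc lo t (d ∸ t)) ⟩
      lo + t + (d ∸ t)   ∎
      where open ≤-Reasoning

  Increasing-onto : ∀ lo → lo ≤ f 0 → (∀ v → lo ≤ v → v ≤ lo + d → ∃ λ s → s ≤ d × f s ≡ v) →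
                    ∀ t → t ≤ d → f t ≡ lo + t
  Increasing-onto lo lo≤ onto t t≤d = ≤-antisym (upper t t≤d) (≤-trans (+-monoˡ-≤ t lo≤) (Increasing-lower t t≤d))
    where
    upper : ∀ t → t ≤ d → f t ≤ lo + t
    upper t t≤d with onto (lo + t) (m≤m+n lo t) (+-monoʳ-≤ lo t≤d)
    ... | s , s≤d , fs≡ with t ≤? s
    ... | yes t≤s = ≤-trans (Increasing-mono t s t≤s s≤d) (≤-reflexive fs≡)
    upper (suc t) t<d | s , s≤d , fs≡ | no t≰s = ⊥-elim (<-irrefl refl (begin-strict
      lo + suc t ≡⟨ sym fs≡ ⟩
      f s        ≤⟨ Increasing-mono s t (≤-pred (≰⇒> t≰s)) (<⇒≤ t<d) ⟩
      f t        ≤⟨ upper t (<⇒≤ t<d) ⟩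
      lo + t     <⟨ +-monoʳ-< lo (n<1+n t) ⟩
      lo + suc t ∎))
      where open ≤-Reasoning
    upper zero _ | _ | no 0≰s = ⊥-elim (0≰s z≤n)

module Structure {n : ℕ} {P C : ℕ → ℕ} (cy : InA n P C) where
  open InA cy public

  C-≢ : ∀ {i j} → 1 ≤ i → i ≤ n → 1 ≤ j → j ≤ n → i ≢ j → C i ≢ C j
  C-≢ 1≤i i≤n 1≤j j≤n i≢j eq = i≢j (C-injective _ _ 1≤i i≤n 1≤j j≤n eq)

  P-≢ : ∀ {x y} → 1 ≤ x → x ≤ n → 1 ≤ y → y ≤ n → x ≢ y → P x ≢ P y
  P-≢ 1≤x x≤n 1≤y y≤n x≢y eq = x≢y (P-injective _ _ 1≤x x≤n 1≤y y≤n eq)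

  C≥2 : ∀ {i} → 2 ≤ i → i ≤ n → 2 ≤ C i
  C≥2 2≤i i≤n = ≤∧≢⇒< (proj₁ (C-range _ 1≤i i≤n))
                      (λ eq → C-≢ ≤-refl (≤-trans 1≤i i≤n) 1≤i i≤n (<⇒≢ 2≤i) (trans C-1 eq))
    where 1≤i = ≤-trans (s≤s z≤n) 2≤i

  C≥3 : ∀ {i R} → C R ≡ 2 → 1 ≤ R → R ≤ n → 2 ≤ i → i ≤ n → i ≢ R → 3 ≤ C i
  C≥3 CR≡2 1≤R R≤n 2≤i i≤n i≢R =
    ≤∧≢⇒< (C≥2 2≤i i≤n) (λ eq → C-≢ 1≤R R≤n (≤-trans (s≤s z≤n) 2≤i) i≤n (λ R≡i → i≢R (sym R≡i)) (trans CR≡2 eq))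

  -- a descent C i > C (i + 1) before the maximum C b would be the 21 of a 213
  increasing-before-max : ∀ a b → 1 ≤ a → b ≤ n → (∀ i → a ≤ i → i < b → C i < C b) →
                          ∀ i → a ≤ i → i < b → C i < C (suc i)
  increasing-before-max a b 1≤a b≤n max i a≤i i<b with suc i ≟ b
  ... | yes refl = max i a≤i i<b
  ... | no  si≢b = ≤∧≢⇒< (≮⇒≥ descent) (C-≢ 1≤i (≤-trans (<⇒≤ i<b) b≤n) (s≤s z≤n) (≤-trans i<b b≤n) (<⇒≢ (n<1+n i)))
    where
    1≤i = ≤-trans 1≤a a≤i
    descent : C (suc i) < C i → ⊥
    descent lt = C-avoids-213 i (suc i) b 1≤i (n<1+n i) (≤∧≢⇒< i<b si≢b) b≤n lt (max i a≤i i<b)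

  P≢1⇒1<P : ∀ {m x} → 1 ≤ m → m ≤ n → P m ≡ 1 → 1 ≤ x → x ≤ n → m ≢ x → 1 < P x
  P≢1⇒1<P 1≤m m≤n Pm≡1 1≤x x≤n m≢x =
    ≤∧≢⇒< (proj₁ (P-range _ 1≤x x≤n)) (λ eq → P-≢ 1≤m m≤n 1≤x x≤n m≢x (trans Pm≡1 eq))

  P≢1,2⇒3≤P : ∀ {a b x} → 1 ≤ a → a ≤ n → P a ≡ 1 → 1 ≤ b → b ≤ n → P b ≡ 2 →
               1 ≤ x → x ≤ n → x ≢ a → x ≢ b → 3 ≤ P x
  P≢1,2⇒3≤P 1≤a a≤n Pa≡1 1≤b b≤n Pb≡2 1≤x x≤n x≢a x≢b =
    ≤∧≢⇒< (P≢1⇒1<P 1≤a a≤n Pa≡1 1≤x x≤n (λ a≡x → x≢a (sym a≡x)))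
           (λ 2≡Px → P-≢ 1≤x x≤n 1≤b b≤n x≢b (trans (sym 2≡Px) (sym Pb≡2)))

  -- with the 1 of P at position m, a valley P y after m completes a 1324 or a 1423
  no-valley-after-1 : ∀ m → 1 ≤ m → m ≤ n → P m ≡ 1 →
                      ∀ x y z → m < x → x < y → y < z → z ≤ n → P y < P x → P y < P z → ⊥
  no-valley-after-1 m 1≤m m≤n Pm≡1 x y z m<x x<y y<z z≤n′ yx yz = by-cases (<-cmp (P x) (P z))
    where
    1≤x = ≤-trans 1≤m (<⇒≤ m<x)
    x<z = <-trans x<y y<z
    Pm<Py : P m < P y
    Pm<Py = subst (_< P y) (sym Pm≡1)
              (P≢1⇒1<P 1≤m m≤n Pm≡1 (≤-trans 1≤x (<⇒≤ x<y)) (≤-trans (<⇒≤ y<z) z≤n′) (<⇒≢ (<-trans m<x x<y)))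
    by-cases : Tri (P x < P z) (P x ≡ P z) (P x > P z) → ⊥
    by-cases (tri< xz _ _) = P-avoids-1324 m x y z 1≤m m<x x<y y<z z≤n′ Pm<Py yx xz
    by-cases (tri≈ _ xz _) = P-≢ 1≤x (≤-trans (<⇒≤ x<z) z≤n′) (≤-trans 1≤x (<⇒≤ x<z)) z≤n′ (<⇒≢ x<z) xz
    by-cases (tri> _ _ zx) = P-avoids-1423 m x y z 1≤m m<x x<y y<z z≤n′ Pm<Py yz zx

-- The cycle visits the values m + 1, ..., n exactly at the positions 2, ..., q and then steps
-- from m + 1 to 2; Shape says that it does so as k, k + 1, ..., n, k - 1, k - 2, ..., m + 1.
module Block {n : ℕ} {P C : ℕ → ℕ} (cy : InA n P C) (m q : ℕ) (2≤m : 2 ≤ m) (3≤q : 3 ≤ q) (q<n : q < n)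
             (q+m≡1+n : q + m ≡ suc n) (Cq≡1+m : C q ≡ suc m) (Csq≡2 : C (suc q) ≡ 2)
             (top-range : ∀ i → 2 ≤ i → i ≤ q → m < C i)
             (top-onto : ∀ v → m < v → v ≤ n → ∃ λ i → 2 ≤ i × i ≤ q × C i ≡ v)
             (Pm≡1 : P m ≡ 1) where
  open Structure cy

  private
    1≤m : 1 ≤ m
    1≤m = ≤-trans (s≤s z≤n) 2≤m
    1≤q : 1 ≤ q
    1≤q = ≤-trans (s≤s z≤n) 3≤q
    2≤q : 2 ≤ q
    2≤q = ≤-trans (n≤1+n 2) 3≤q
    2<n : 2 < n
    2<n = ≤-trans (s≤s 2≤q) q<n

  k : ℕ
  k = C 2

  private
    m<k : m < k
    m<k = top-range 2 ≤-refl 2≤q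
    k≤n : k ≤ n
    k≤n = proj₂ (C-range 2 (s≤s z≤n) (<⇒≤ 2<n))
    2+m≤k : 2 + m ≤ k
    2+m≤k = ≤∧≢⇒< m<k (λ 1+m≡k → <⇒≢ 3≤q (sym (C-injective q 2 1≤q (<⇒≤ q<n) (s≤s z≤n) (<⇒≤ 2<n) (trans Cq≡1+m 1+m≡k))))
    m<n : m < n
    m<n = <-≤-trans m<k k≤n
    P[1+m]≡2 : P (suc m) ≡ 2
    P[1+m]≡2 = subst (λ x → P x ≡ 2) Cq≡1+m (trans (P-step q 1≤q q<n) Csq≡2)

  top-position : ∀ i → 1 ≤ i → i ≤ n → m < C i → 2 ≤ i × i ≤ q
  top-position i 1≤i i≤n m<Ci with top-onto (C i) m<Ci (proj₂ (C-range i 1≤i i≤n))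
  ... | j , 2≤j , j≤q , Cj≡Ci with C-injective j i (≤-trans (s≤s z≤n) 2≤j) (≤-trans j≤q (<⇒≤ q<n)) 1≤i i≤n Cj≡Ci
  ... | refl = 2≤j , j≤q

  P-top : ∀ x → m < x → x ≤ n → x ≢ suc m → m < P x
  P-top x m<x x≤n x≢1+m with top-onto x m<x x≤n
  ... | i , 2≤i , i≤q , refl with i ≟ q
  ...   | yes refl = ⊥-elim (x≢1+m Cq≡1+m)
  ...   | no  i≢q  = subst (m <_) (sym (P-step i (≤-trans (s≤s z≤n) 2≤i) (≤-<-trans i≤q q<n)))
                       (top-range (suc i) (≤-trans 2≤i (n≤1+n i)) (≤∧≢⇒< i≤q i≢q))

  P-top-preimage : ∀ v → m < v → v ≤ n → v ≢ k → ∃ λ x → m < x × x ≤ n × P x ≡ v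
  P-top-preimage v m<v v≤n v≢k with top-onto v m<v v≤n
  ... | 1 , s≤s () , _ , _
  ... | 2 , _ , _ , C2≡v = ⊥-elim (v≢k (sym C2≡v))
  ... | suc (suc (suc i)) , _ , i≤q , C≡v =
    C (2 + i) , top-range (2 + i) (s≤s (s≤s z≤n)) (≤-trans (n≤1+n _) i≤q) ,
    proj₂ (C-range (2 + i) (s≤s z≤n) (≤-trans (n≤1+n _) (≤-trans i≤q (<⇒≤ q<n)))) ,
    trans (P-step (2 + i) (s≤s z≤n) (<-trans i≤q q<n)) C≡v

  Descending : ℕ → Set
  Descending v = ∀ x → suc m ≤ x → suc x ≤ v → P (suc x) ≡ x

  Descending-extend : ∀ v → Descending v → P (suc v) ≡ v → Descending (suc v)
  Descending-extend v desc P[1+v]≡v x 1+m≤x x<1+v with x ≟ v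
  ... | yes refl = P[1+v]≡v
  ... | no  x≢v  = desc x 1+m≤x (≤∧≢⇒< (≤-pred x<1+v) x≢v)

  -- if P y < v, then P (1 + P y) = P y already, so y = 1 + P y ≤ v
  Descending-above : ∀ v → v ≤ n → Descending v → ∀ x → 1 ≤ x → x ≤ n → P x ≡ v →
                     ∀ y → m < y → y ≤ n → y ≢ suc m → v < y → y ≢ x → v < P y
  Descending-above v v≤n desc x 1≤x x≤n Px≡v y m<y y≤n y≢1+m v<y y≢x with <-cmp (P y) v
  ... | tri> _ _ v<Py = v<Py
  ... | tri≈ _ Py≡v _ = ⊥-elim (P-≢ (≤-trans (s≤s z≤n) m<y) y≤n 1≤x x≤n y≢x (trans Py≡v (sym Px≡v)))
  ... | tri< Py<v _ _ = ⊥-elim (<⇒≱ v<y (subst (_≤ v) (sym y≡) Py<v))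
    where
    P[1+Py]≡Py : P (suc (P y)) ≡ P y
    P[1+Py]≡Py = desc (P y) (P-top y m<y y≤n y≢1+m) Py<v
    y≡ : y ≡ suc (P y)
    y≡ = P-injective y (suc (P y)) (≤-trans (s≤s z≤n) m<y) y≤n (s≤s z≤n) (≤-trans Py<v v≤n) (sym P[1+Py]≡Py)

  private
    no-valley = no-valley-after-1 m 1≤m (<⇒≤ m<n) Pm≡1
    1+m<n : suc m < n
    1+m<n = <-≤-trans 2+m≤k k≤n

  Descending-grow : ∀ d → suc m + d ≤ k → Descending (suc m + d) ⊎ (∃ λ v → m < v × v < k × Descending v × P n ≡ v)
  Descending-grow zero _ = inj₁ λ x m<x x<1+m+0 → ⊥-elim (<⇒≱ m<x (subst (x ≤_) (+-identityʳ m) (≤-pred x<1+m+0)))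
  Descending-grow (suc d) 2+m+d≤k with Descending-grow d (≤-trans (+-monoʳ-≤ (suc m) (n≤1+n d)) 2+m+d≤k)
  ... | inj₂ peak = inj₂ peak
  ... | inj₁ desc = grow (P-top-preimage v m<v v≤n (<⇒≢ v<k))
    where
    v = suc m + d
    v<k : v < k
    v<k = subst (_≤ k) (+-suc (suc m) d) 2+m+d≤k
    m<v : m < v
    m<v = s≤s (m≤m+n m d)
    v≤n : v ≤ n
    v≤n = <⇒≤ (<-≤-trans v<k k≤n)
    not-below : ∀ x → m < x → x ≤ v → P x ≢ v
    not-below (suc x) m<x x≤v Px≡v with m ≟ x
    ... | yes refl = <⇒≢ (≤-<-trans 2≤m m<v) (trans (sym P[1+m]≡2) Px≡v)
    ... | no  m≢x  = <⇒≢ x≤v (trans (sym (desc x (≤∧≢⇒< (≤-pred m<x) m≢x) x≤v)) Px≡v)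
    grow : (∃ λ x → m < x × x ≤ n × P x ≡ v) → Descending (suc m + suc d) ⊎ (∃ λ v → m < v × v < k × Descending v × P n ≡ v)
    grow (x , m<x , x≤n , Px≡v) with x ≟ suc v | x ≟ n | x ≤? v
    ... | yes refl | _        | _       = inj₁ (subst Descending (sym (+-suc (suc m) d)) (Descending-extend v desc Px≡v))
    ... | no _     | yes refl | _       = inj₂ (v , m<v , v<k , desc , Px≡v)
    ... | no _     | no _     | yes x≤v = ⊥-elim (not-below x m<x x≤v Px≡v)
    ... | no x≢1+v | no x≢n   | no x≰v  = ⊥-elim (
      no-valley (suc v) x n (s≤s (<⇒≤ m<v)) 1+v<x (≤∧≢⇒< x≤n x≢n) ≤-refl
        (subst (_< P (suc v)) (sym Px≡v)
          (above (suc v) (s≤s (<⇒≤ m<v)) (<-≤-trans v<k k≤n) (λ eq → <⇒≢ m<v (suc-injective (sym eq))) ≤-refl (λ eq → x≢1+v (sym eq))))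
        (subst (_< P n) (sym Px≡v)
          (above n m<n ≤-refl (λ eq → <⇒≢ 1+m<n (sym eq)) (<-≤-trans v<k k≤n) (λ eq → x≢n (sym eq)))))
      where
      above = Descending-above v v≤n desc x (≤-trans (s≤s z≤n) m<x) x≤n Px≡v
      1+v<x : suc v < x
      1+v<x = ≤∧≢⇒< (≰⇒> x≰v) (λ eq → x≢1+v (sym eq))

  Descending-run : ∀ a w → 1 ≤ a → a ≤ n → C a ≡ w → Descending w →
                   ∀ s → m + s < w → a + s ≤ q × C (a + s) + s ≡ w
  Descending-run a w 1≤a a≤n Ca≡w desc zero m+0<w rewrite +-identityʳ a | +-identityʳ (C a) =
    proj₂ (top-position a 1≤a a≤n (subst (m <_) (sym Ca≡w) (subst (_< w) (+-identityʳ m) m+0<w))) , Ca≡w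
  Descending-run a w 1≤a a≤n Ca≡w desc (suc s) m+1+s<w
    with Descending-run a w 1≤a a≤n Ca≡w desc s (<-trans (+-monoʳ-< m (n<1+n s)) m+1+s<w)
  ... | a+s≤q , Ca+s+s≡w with m≤n⇒∃[o]m+o≡n 2+m≤Ca+s
    where
    2+m≤Ca+s : 2 + m ≤ C (a + s)
    2+m≤Ca+s = +-cancelʳ-≤ s (2 + m) (C (a + s))
                 (subst (2 + m + s ≤_) (sym Ca+s+s≡w) (subst (_≤ w) (cong suc (+-suc m s)) m+1+s<w))
  ... | o , 2+m+o≡Ca+s = a+1+s≤q , Ca+1+s+1+s≡w
    where
    C[1+a+s]≡ : C (suc (a + s)) ≡ suc m + o
    C[1+a+s]≡ = begin
      C (suc (a + s))       ≡⟨ P-step (a + s) (≤-trans 1≤a (m≤m+n a s)) (≤-<-trans a+s≤q q<n) ⟨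
      P (C (a + s))         ≡⟨ cong P 2+m+o≡Ca+s ⟨
      P (suc (suc m + o))   ≡⟨ desc (suc m + o) (m≤m+n (suc m) o) (≤-trans (≤-reflexive 2+m+o≡Ca+s) (subst (C (a + s) ≤_) Ca+s+s≡w (m≤m+n _ s))) ⟩
      suc m + o             ∎
      where open ≡-Reasoning
    a+1+s≤q : a + suc s ≤ q
    a+1+s≤q = subst (_≤ q) (sym (+-suc a s))
                (proj₂ (top-position (suc (a + s)) (s≤s z≤n) (≤-trans (s≤s a+s≤q) q<n)
                         (subst (m <_) (sym C[1+a+s]≡) (s≤s (m≤m+n m o)))))
    Ca+1+s+1+s≡w : C (a + suc s) + suc s ≡ w
    Ca+1+s+1+s≡w = begin
      C (a + suc s) + suc s   ≡⟨ cong (λ i → C i + suc s) (+-suc a s) ⟩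
      C (suc (a + s)) + suc s ≡⟨ cong (_+ suc s) C[1+a+s]≡ ⟩
      suc m + o + suc s       ≡⟨ +-suc (suc m + o) s ⟩
      suc (suc m + o) + s     ≡⟨ cong (_+ s) 2+m+o≡Ca+s ⟩
      C (a + s) + s           ≡⟨ Ca+s+s≡w ⟩
      w                       ∎
      where open ≡-Reasoning

  TopShape : ℕ → ℕ → Set
  TopShape dd u = (∀ t → t ≤ u → C (2 + t) ≡ suc m + dd + t) × (∀ s → s < dd → C (3 + u + s) + s ≡ m + dd)

  Shape : Set
  Shape = ∃ λ dd → ∃ λ u → 1 ≤ dd × q ≡ 2 + u + dd × n ≡ suc m + dd + u × TopShape dd u

  private
    q≡ : ∀ dd u → n ≡ suc m + dd + u → q ≡ 2 + u + dd
    q≡ dd u n≡ = +-cancelʳ-≡ m q (2 + u + dd) (trans q+m≡1+n (trans (cong suc n≡) (arith m dd u)))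
      where
      arith : ∀ m dd u → suc (suc m + dd + u) ≡ 2 + u + dd + m
      arith = solve-∀

    1≤dd : ∀ dd → suc m + dd ≡ k → 1 ≤ dd
    1≤dd zero    1+m+0≡k = ⊥-elim (<⇒≢ 2+m≤k (trans (cong suc (sym (+-identityʳ m))) 1+m+0≡k))
    1≤dd (suc _) _       = s≤s z≤n

  shape-descending : ∀ dd → suc m + dd ≡ k → Descending k → Shape
  shape-descending dd 1+m+dd≡k desc = dd , 0 , 1≤dd dd 1+m+dd≡k , q≡ dd 0 n≡ , n≡ , top , down
    where
    C3≡ : C 3 ≡ m + dd
    C3≡ = begin
      C 3             ≡⟨ P-step 2 (s≤s z≤n) 2<n ⟨
      P k             ≡⟨ cong P 1+m+dd≡k ⟨
      P (suc m + dd)  ≡⟨ desc (m + dd) (subst (_≤ m + dd) (+-comm m 1) (+-monoʳ-≤ m (1≤dd dd 1+m+dd≡k))) (≤-reflexive 1+m+dd≡k) ⟩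
      m + dd          ∎
      where open ≡-Reasoning
    C3<k : C 3 < k
    C3<k = subst₂ _<_ (sym C3≡) 1+m+dd≡k ≤-refl
    k≡n : k ≡ n
    k≡n with k ≟ n
    ... | yes k≡n = k≡n
    ... | no  k≢n with top-onto n m<n ≤-refl
    ...   | 1 , s≤s () , _ , _
    ...   | 2 , _ , _ , C2≡n = ⊥-elim (k≢n C2≡n)
    ...   | 3 , _ , _ , C3≡n = ⊥-elim (<⇒≱ C3<k (subst (k ≤_) (sym C3≡n) k≤n))
    ...   | suc (suc (suc (suc i))) , _ , i≤q , Ci≡n =
            ⊥-elim (C-avoids-213 2 3 (4 + i) (s≤s z≤n) ≤-refl (s≤s (s≤s (s≤s (s≤s z≤n)))) (≤-trans i≤q (<⇒≤ q<n))
                      C3<k (subst (k <_) (sym Ci≡n) (≤∧≢⇒< k≤n k≢n)))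
    n≡ : n ≡ suc m + dd + 0
    n≡ = trans (sym k≡n) (trans (sym 1+m+dd≡k) (sym (+-identityʳ _)))
    top : ∀ t → t ≤ 0 → C (2 + t) ≡ suc m + dd + t
    top zero _ = sym (trans (+-identityʳ _) 1+m+dd≡k)
    down : ∀ s → s < dd → C (3 + 0 + s) + s ≡ m + dd
    down s s<dd = proj₂ (Descending-run 3 (m + dd) (s≤s z≤n) (≤-trans 3≤q (<⇒≤ q<n)) C3≡
                          (λ x m<x x<m+dd → desc x m<x (≤-trans x<m+dd (≤-trans (n≤1+n _) (≤-reflexive 1+m+dd≡k))))
                          s (+-monoʳ-< m s<dd))

  shape-peak : ∀ dd → suc m + dd ≡ k → ∀ v → m < v → v < k → Descending v → P n ≡ v → Shape
  shape-peak dd 1+m+dd≡k v m<v v<k desc Pn≡v with top-onto n m<n ≤-refl | m≤n⇒∃[o]m+o≡n m<v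
  ... | j , 2≤j , j≤q , Cj≡n | s* , 1+m+s*≡v with m≤n⇒∃[o]m+o≡n 2≤j
  ... | u , refl = dd , u , 1≤dd dd 1+m+dd≡k , q≡ dd u n≡ , n≡ , top , down
    where
    j<n = ≤-<-trans j≤q q<n
    C3+u≡v : C (3 + u) ≡ v
    C3+u≡v = trans (sym (P-step (2 + u) (s≤s z≤n) j<n)) (trans (cong P Cj≡n) Pn≡v)
    run = Descending-run (3 + u) v (s≤s z≤n) j<n C3+u≡v desc
    3+u+s*≡q : 3 + u + s* ≡ q
    3+u+s*≡q = C-injective _ _ (s≤s z≤n) (≤-trans (proj₁ run*) (<⇒≤ q<n)) (≤-trans (s≤s z≤n) 3≤q) (<⇒≤ q<n)
                 (trans (+-cancelʳ-≡ s* _ _ (trans (proj₂ run*) (sym 1+m+s*≡v))) (sym Cq≡1+m))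
      where run* = run s* (subst (m + s* <_) 1+m+s*≡v ≤-refl)
    below-max : ∀ i → 2 ≤ i → i < 2 + u → C i < C (2 + u)
    below-max i 2≤i i<j = subst (C i <_) (sym Cj≡n)
      (≤∧≢⇒< (proj₂ (C-range i (≤-trans (s≤s z≤n) 2≤i) (<⇒≤ (<-trans i<j j<n))))
             (λ Ci≡n → <⇒≢ i<j (C-injective i (2 + u) (≤-trans (s≤s z≤n) 2≤i) (<⇒≤ (<-trans i<j j<n)) (s≤s z≤n) (<⇒≤ j<n)
                                              (trans Ci≡n (sym Cj≡n)))))
    inc : Increasing (λ t → C (2 + t)) u
    inc t t<u = increasing-before-max 2 (2 + u) (s≤s z≤n) (<⇒≤ j<n) below-max (2 + t) (s≤s (s≤s z≤n)) (+-monoʳ-< 2 t<u)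
    k+u≤n : k + u ≤ n
    k+u≤n = subst (k + u ≤_) Cj≡n (Increasing-lower inc u ≤-refl)
    s*<dd : s* < dd
    s*<dd = +-cancelˡ-< (suc m) s* dd (subst₂ _<_ (sym 1+m+s*≡v) (sym 1+m+dd≡k) v<k)
    n≡2+u+s*+m : n ≡ 2 + u + s* + m
    n≡2+u+s*+m = suc-injective (trans (sym q+m≡1+n) (cong (_+ m) (sym 3+u+s*≡q)))
    dd≡1+s* : dd ≡ suc s*
    dd≡1+s* = ≤-antisym (+-cancelˡ-≤ (suc m + u) dd (suc s*) (subst₂ _≤_ (arith₁ m dd u) (trans n≡2+u+s*+m (arith₂ m u s*))
                                                                   (subst (λ x → x + u ≤ n) (sym 1+m+dd≡k) k+u≤n)))
                        s*<dd
      where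
      arith₁ : ∀ m dd u → suc m + dd + u ≡ suc m + u + dd
      arith₁ = solve-∀
      arith₂ : ∀ m u s → 2 + u + s + m ≡ suc m + u + suc s
      arith₂ = solve-∀
    n≡ : n ≡ suc m + dd + u
    n≡ = trans n≡2+u+s*+m (trans (arith m u s*) (cong (λ d → suc m + d + u) (sym dd≡1+s*)))
      where
      arith : ∀ m u s → 2 + u + s + m ≡ suc m + suc s + u
      arith = solve-∀
    top : ∀ t → t ≤ u → C (2 + t) ≡ suc m + dd + t
    top t t≤u = trans (Increasing-squeeze inc k ≤-refl (≤-reflexive (trans Cj≡n (trans n≡ (cong (_+ u) 1+m+dd≡k)))) t t≤u)
                      (cong (_+ t) (sym 1+m+dd≡k))
    v≡m+dd : v ≡ m + dd
    v≡m+dd = trans (sym 1+m+s*≡v) (trans (sym (+-suc m s*)) (cong (m +_) (sym dd≡1+s*)))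
    down : ∀ s → s < dd → C (3 + u + s) + s ≡ m + dd
    down s s<dd = trans (proj₂ (run s (subst (m + s <_) (sym v≡m+dd) (+-monoʳ-< m s<dd)))) v≡m+dd

  shape : Shape
  shape with m≤n⇒∃[o]m+o≡n m<k
  ... | dd , 1+m+dd≡k with Descending-grow dd (≤-reflexive 1+m+dd≡k)
  ...   | inj₁ desc = shape-descending dd 1+m+dd≡k (subst Descending 1+m+dd≡k desc)
  ...   | inj₂ (v , m<v , v<k , desc , Pn≡v) = shape-peak dd 1+m+dd≡k v m<v v<k desc Pn≡v

-- C is the cycle form (1, k, ..., n, k-1, ..., 3+l, 2, 3, ..., 2+l) with k = 3 + l + dd and
-- n = 3 + l + dd + u; the falling block is stated as C (3 + u + s) + s = k - 1 to avoid
-- truncated subtraction.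
record CycleShape (l dd u : ℕ) (C : ℕ → ℕ) : Set where
  field
    rise : ∀ t → t ≤ u → C (2 + t) ≡ 3 + l + dd + t
    fall : ∀ s → s < dd → C (3 + u + s) + s ≡ 2 + l + dd
    two  : C (3 + u + dd) ≡ 2
    tail : ∀ t → t < l → C (4 + u + dd + t) ≡ 3 + t

module LeftAnalysis {n : ℕ} {P C : ℕ → ℕ} (cy : InA n P C) (q : ℕ) (3≤q : 3 ≤ q) (1+q<n : suc q < n)
                    (C[1+q]≡2 : C (suc q) ≡ 2) (Cq≢n : C q ≢ n) where
  open Structure cy

  private
    r = suc q
    1≤q : 1 ≤ q
    1≤q = ≤-trans (s≤s z≤n) 3≤q
    1≤r : 1 ≤ r
    1≤r = s≤s z≤n
    r≤n : r ≤ n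
    r≤n = <⇒≤ 1+q<n
    q<n : q < n
    q<n = <-trans (n<1+n q) 1+q<n
    Cq≤n : C q ≤ n
    Cq≤n = proj₂ (C-range q 1≤q (<⇒≤ q<n))
    Cq<n : C q < n
    Cq<n = ≤∧≢⇒< Cq≤n Cq≢n
    P[Cq]≡2 : P (C q) ≡ 2
    P[Cq]≡2 = trans (P-step q 1≤q q<n) C[1+q]≡2

  top>bottom : ∀ i j → 2 ≤ i → i < r → r < j → j ≤ n → C j < C i
  top>bottom i j 2≤i i<r r<j j≤n =
    ≤∧≢⇒< (≮⇒≥ (λ Ci<Cj → C-avoids-213 i r j 1≤i i<r r<j j≤n (subst (_< C i) (sym C[1+q]≡2) 3≤Ci) Ci<Cj))
           (λ Cj≡Ci → <⇒≢ (<-trans i<r r<j) (C-injective i j 1≤i (≤-trans (<⇒≤ i<r) r≤n) (≤-trans 1≤r (<⇒≤ r<j)) j≤n (sym Cj≡Ci)))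
    where
    1≤i = ≤-trans (s≤s z≤n) 2≤i
    3≤Ci = C≥3 C[1+q]≡2 1≤r r≤n 2≤i (≤-trans (<⇒≤ i<r) r≤n) (<⇒≢ i<r)

  private
    P[1+Cq]-large : ∀ j → r < j → j < n → C (suc j) < P (suc (C q))
    P[1+Cq]-large j r<j j<n with C-surjective (suc (C q)) (s≤s z≤n) Cq<n
    ... | i , 1≤i , i≤n , Ci≡1+Cq with <-cmp i q
    ...   | tri≈ _ refl _ = ⊥-elim (<⇒≢ (n<1+n (C q)) Ci≡1+Cq)
    ...   | tri< i<q _ _ with i ≟ 1
    ...     | yes refl = ⊥-elim (<⇒≢ (s≤s (proj₁ (C-range q 1≤q (<⇒≤ q<n)))) (sym (trans (sym Ci≡1+Cq) C-1)))
    ...     | no  i≢1  = subst (C (suc j) <_) (trans (sym (P-step i 1≤i (<-trans i<q q<n))) (cong P Ci≡1+Cq))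
                           (top>bottom (suc i) (suc j) (s≤s 1≤i) (s≤s i<q) (<-trans r<j (n<1+n j)) j<n)
    P[1+Cq]-large j r<j j<n | i , 1≤i , i≤n , Ci≡1+Cq | tri> _ _ q<i with i ≟ r
    ...     | yes refl = ⊥-elim (<⇒≢ (≤-trans (s≤s (s≤s z≤n)) 3≤q)
                           (C-injective 1 q ≤-refl (≤-trans 1≤r r≤n) 1≤q (<⇒≤ q<n) (trans C-1 (suc-injective (trans (sym C[1+q]≡2) Ci≡1+Cq)))))
    ...     | no  i≢r  = ⊥-elim (<-irrefl refl (<-trans (subst (_< C q) Ci≡1+Cq
                           (top>bottom q i (≤-trans (s≤s (s≤s z≤n)) 3≤q) (n<1+n q) (≤∧≢⇒< q<i (λ r≡i → i≢r (sym r≡i))) i≤n)) (n<1+n (C q))))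

  -- C n < C j would make the positions C n < C j < C q < C q + 1 a 1324 in P
  bottom<last : ∀ j → r < j → j < n → C j < C n
  bottom<last j r<j j<n =
    ≤∧≢⇒< (≮⇒≥ larger) (C-≢ 1≤j (<⇒≤ j<n) (≤-trans 1≤j (<⇒≤ j<n)) ≤-refl (<⇒≢ j<n))
    where
    1≤j = ≤-trans 1≤r (<⇒≤ r<j)
    3≤C[1+j] : 2 < C (suc j)
    3≤C[1+j] = C≥3 C[1+q]≡2 1≤r r≤n (s≤s (≤-trans (s≤s z≤n) 1≤j)) j<n (λ eq → <⇒≢ (<-trans r<j (n<1+n j)) (sym eq))
    larger : C n < C j → ⊥
    larger Cn<Cj = P-avoids-1324 (C n) (C j) (C q) (suc (C q))
      (proj₁ (C-range n (≤-trans 1≤r r≤n) ≤-refl)) Cn<Cj (top>bottom q j (≤-trans (s≤s (s≤s z≤n)) 3≤q) (n<1+n q) r<j (<⇒≤ j<n))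
      (n<1+n (C q)) Cq<n
      (subst₂ _<_ (sym P-last) (sym P[Cq]≡2) (s≤s ≤-refl))
      (subst₂ _<_ (sym P[Cq]≡2) (sym (P-step j 1≤j j<n)) 3≤C[1+j])
      (subst (_< P (suc (C q))) (sym (P-step j 1≤j j<n)) (P[1+Cq]-large j r<j j<n))

  LeftShape : Set
  LeftShape = ∃ λ l → ∃ λ dd → ∃ λ u → 1 ≤ dd × n ≡ 3 + l + dd + u × q ≡ 2 + u + dd × CycleShape l dd u C

  module Bottom (l′ : ℕ) (1+r+l′≡n : suc r + l′ ≡ n) where
    private
      bottom : ℕ → ℕ
      bottom t = C (suc r + t)
      1+r+t≤n : ∀ t → t ≤ l′ → suc r + t ≤ n
      1+r+t≤n t t≤l′ = subst (suc r + t ≤_) 1+r+l′≡n (+-monoʳ-≤ (suc r) t≤l′)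
      inc : Increasing bottom l′
      inc t t<l′ = subst (λ i → bottom t < C i) (sym (+-suc (suc r) t))
                     (increasing-before-max (suc r) n (s≤s z≤n) ≤-refl bottom<last (suc r + t) (m≤m+n (suc r) t)
                                            (subst (suc r + t <_) 1+r+l′≡n (+-monoʳ-< (suc r) t<l′)))
      3≤bottom0 : 3 ≤ bottom 0
      3≤bottom0 = C≥3 C[1+q]≡2 1≤r r≤n (s≤s (s≤s z≤n)) (1+r+t≤n 0 z≤n) (λ eq → <⇒≢ (s≤s (m≤m+n r 0)) (sym eq))
      3+l′≤Cn : 3 + l′ ≤ C n
      3+l′≤Cn = subst (3 + l′ ≤_) (cong C 1+r+l′≡n) (≤-trans (+-monoˡ-≤ l′ 3≤bottom0) (Increasing-lower inc l′ ≤-refl))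
      bottom-onto : ∀ v → 3 ≤ v → v ≤ 3 + l′ → ∃ λ s → s ≤ l′ × bottom s ≡ v
      bottom-onto v 3≤v v≤ with C-surjective v (≤-trans (s≤s z≤n) 3≤v) (≤-trans v≤ (≤-trans 3+l′≤Cn (proj₂ (C-range n (≤-trans 1≤r r≤n) ≤-refl))))
      ... | i , 1≤i , i≤n , Ci≡v with <-cmp i r
      ...   | tri≈ _ refl _ = ⊥-elim (<⇒≢ 3≤v (sym (trans (sym Ci≡v) C[1+q]≡2)))
      ...   | tri> _ _ r<i with m≤n⇒∃[o]m+o≡n r<i
      ...     | s , refl = s , +-cancelˡ-≤ (suc r) s l′ (subst (suc r + s ≤_) (sym 1+r+l′≡n) i≤n) , Ci≡v
      bottom-onto v 3≤v v≤ | i , 1≤i , i≤n , Ci≡v | tri< i<r _ _ with i ≟ 1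
      ...     | yes refl = ⊥-elim (<⇒≢ (≤-trans (s≤s (s≤s z≤n)) 3≤v) (sym (trans (sym Ci≡v) C-1)))
      ...     | no  i≢1  = ⊥-elim (<⇒≱ (top>bottom i n (≤∧≢⇒< 1≤i (λ 1≡i → i≢1 (sym 1≡i))) i<r 1+q<n ≤-refl)
                                        (subst (_≤ C n) (sym Ci≡v) (≤-trans v≤ 3+l′≤Cn)))
      bottom≡ : ∀ t → t ≤ l′ → C (suc r + t) ≡ 3 + t
      bottom≡ = Increasing-onto inc 3 3≤bottom0 bottom-onto
      m = 3 + l′
      Cn≡m : C n ≡ m
      Cn≡m = trans (cong C (sym 1+r+l′≡n)) (bottom≡ l′ ≤-refl)
      top-range : ∀ i → 2 ≤ i → i ≤ q → m < C i
      top-range i 2≤i i≤q = subst (_< C i) Cn≡m (top>bottom i n 2≤i (s≤s i≤q) 1+q<n ≤-refl)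
      top-onto : ∀ v → m < v → v ≤ n → ∃ λ i → 2 ≤ i × i ≤ q × C i ≡ v
      top-onto v m<v v≤n with C-surjective v (≤-trans (s≤s z≤n) m<v) v≤n
      ... | i , 1≤i , i≤n , Ci≡v with <-cmp i r
      ...   | tri≈ _ refl _ = ⊥-elim (<⇒≱ m<v (subst (_≤ m) (trans (sym C[1+q]≡2) Ci≡v) (s≤s (s≤s z≤n))))
      ...   | tri> _ _ r<i with m≤n⇒∃[o]m+o≡n r<i
      ...     | s , refl = ⊥-elim (<⇒≱ m<v (subst (_≤ m) (trans (sym (bottom≡ s s≤l′)) Ci≡v) (+-monoʳ-≤ 3 s≤l′)))
        where s≤l′ = +-cancelˡ-≤ (suc r) s l′ (subst (suc r + s ≤_) (sym 1+r+l′≡n) i≤n)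
      top-onto v m<v v≤n | i , 1≤i , i≤n , Ci≡v | tri< i<r _ _ with i ≟ 1
      ...     | yes refl = ⊥-elim (<⇒≱ m<v (subst (_≤ m) (trans (sym C-1) Ci≡v) (s≤s z≤n)))
      ...     | no  i≢1  = i , ≤∧≢⇒< 1≤i (λ 1≡i → i≢1 (sym 1≡i)) , ≤-pred i<r , Ci≡v
      Pm≡1 : P m ≡ 1
      Pm≡1 = subst (λ x → P x ≡ 1) Cn≡m P-last
      m<n : m < n
      m<n = <-≤-trans (top-range q (≤-trans (s≤s (s≤s z≤n)) 3≤q) ≤-refl) Cq≤n
      -- otherwise 1 + m < C q < n and P (C q) = 2 would be a valley after the 1 at m
      Cq≡1+m : C q ≡ suc m
      Cq≡1+m with C q ≟ suc m
      ... | yes eq = eq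
      ... | no  ne = ⊥-elim (no-valley-after-1 m (s≤s z≤n) (<⇒≤ m<n) Pm≡1 (suc m) (C q) n ≤-refl 1+m<Cq Cq<n ≤-refl
                       (subst (_< P (suc m)) (sym P[Cq]≡2) (3≤P (s≤s z≤n) (<⇒≤ (<-trans 1+m<Cq Cq<n)) (<⇒≢ (n<1+n m) ∘ sym) (λ eq → ne (sym eq))))
                       (subst (_< P n) (sym P[Cq]≡2) (3≤P (≤-trans (s≤s z≤n) m<n) ≤-refl (<⇒≢ m<n ∘ sym) (<⇒≢ Cq<n ∘ sym))))
        where
        1+m<Cq : suc m < C q
        1+m<Cq = ≤∧≢⇒< (top-range q (≤-trans (s≤s (s≤s z≤n)) 3≤q) ≤-refl) (λ eq → ne (sym eq))
        3≤P : ∀ {x} → 1 ≤ x → x ≤ n → x ≢ m → x ≢ C q → 3 ≤ P x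
        3≤P = P≢1,2⇒3≤P (s≤s z≤n) (<⇒≤ m<n) Pm≡1 (proj₁ (C-range q 1≤q (<⇒≤ q<n))) Cq≤n P[Cq]≡2
      q+m≡1+n : q + m ≡ suc n
      q+m≡1+n = trans (arith q l′) (cong suc 1+r+l′≡n)
        where
        arith : ∀ q l′ → q + (3 + l′) ≡ suc (suc (suc q) + l′)
        arith = solve-∀
      open Block cy m q (s≤s (s≤s z≤n)) 3≤q q<n q+m≡1+n Cq≡1+m C[1+q]≡2 top-range top-onto Pm≡1 using (Shape; shape)

      from-block : Shape → LeftShape
      from-block (dd , u , 1≤dd , q≡ , n≡ , rise , fall) =
        suc l′ , dd , u , 1≤dd , n≡ , q≡ , record { rise = rise ; fall = fall ; two = two ; tail = tail }
        where
        two : C (3 + u + dd) ≡ 2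
        two = subst (λ i → C (suc i) ≡ 2) q≡ C[1+q]≡2
        tail : ∀ t → t < suc l′ → C (4 + u + dd + t) ≡ 3 + t
        tail t t<l = subst (λ i → C (suc (suc i) + t) ≡ 3 + t) q≡ (bottom≡ t (≤-pred t<l))

    left-shape-with-bottom : LeftShape
    left-shape-with-bottom = from-block shape

  left-shape : LeftShape
  left-shape with m≤n⇒∃[o]m+o≡n 1+q<n
  ... | l′ , 1+r+l′≡n = Bottom.left-shape-with-bottom l′ 1+r+l′≡n

module RightAnalysis {q : ℕ} {P C : ℕ → ℕ} (cy : InA (suc q) P C) (2≤q : 2 ≤ q) (C[1+q]≡2 : C (suc q) ≡ 2) where
  open Structure cy

  private
    n = suc q
    1≤q : 1 ≤ q
    1≤q = ≤-trans (s≤s z≤n) 2≤q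
    q<n : q < n
    q<n = ≤-refl
    top-range : ∀ i → 2 ≤ i → i ≤ q → 2 < C i
    top-range i 2≤i i≤q = C≥3 C[1+q]≡2 (s≤s z≤n) ≤-refl 2≤i (≤-trans i≤q (n≤1+n q)) (<⇒≢ (s≤s i≤q))
    top-onto : ∀ v → 2 < v → v ≤ n → ∃ λ i → 2 ≤ i × i ≤ q × C i ≡ v
    top-onto v 2<v v≤n with C-surjective v (≤-trans (s≤s z≤n) 2<v) v≤n
    ... | 1 , _ , _ , C1≡v = ⊥-elim (<⇒≢ (≤-trans (s≤s (s≤s z≤n)) 2<v) (sym (trans (sym C1≡v) C-1)))
    ... | suc (suc i) , _ , i≤n , Ci≡v with suc (suc i) ≟ n
    ...   | yes refl = ⊥-elim (<⇒≢ 2<v (sym (trans (sym Ci≡v) C[1+q]≡2)))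
    ...   | no  i≢n  = suc (suc i) , s≤s (s≤s z≤n) , ≤-pred (≤∧≢⇒< i≤n i≢n) , Ci≡v
    P2≡1 : P 2 ≡ 1
    P2≡1 = subst (λ x → P x ≡ 1) C[1+q]≡2 P-last
    P[Cq]≡2 : P (C q) ≡ 2
    P[Cq]≡2 = trans (P-step q 1≤q q<n) C[1+q]≡2
    Cq≤n : C q ≤ n
    Cq≤n = proj₂ (C-range q 1≤q (n≤1+n q))

  RightShape : Set
  RightShape = ∃ λ dd → ∃ λ u → n ≡ 3 + 0 + dd + u × CycleShape 0 dd u C

  right-shape : RightShape
  right-shape with C q ≟ n | m≤n⇒∃[o]m+o≡n 2≤q
  ... | yes Cq≡n | u , 2+u≡q = 0 , u , cong suc (sym 2+u≡q) ,
                               record { rise = rise ; fall = λ _ () ; two = two ; tail = λ _ () }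
    where
    below-max : ∀ i → 2 ≤ i → i < q → C i < C q
    below-max i 2≤i i<q = subst (C i <_) (sym Cq≡n)
      (≤∧≢⇒< (proj₂ (C-range i (≤-trans (s≤s z≤n) 2≤i) (≤-trans (<⇒≤ i<q) (n≤1+n q))))
             (λ Ci≡n → <⇒≢ i<q (C-injective i q (≤-trans (s≤s z≤n) 2≤i) (≤-trans (<⇒≤ i<q) (n≤1+n q)) 1≤q (n≤1+n q)
                                              (trans Ci≡n (sym Cq≡n)))))
    inc : Increasing (λ t → C (2 + t)) u
    inc t t<u = increasing-before-max 2 q (s≤s z≤n) (n≤1+n q) below-max (2 + t) (s≤s (s≤s z≤n))
                                      (subst (2 + t <_) 2+u≡q (+-monoʳ-< 2 t<u))
    rise : ∀ t → t ≤ u → C (2 + t) ≡ 3 + 0 + 0 + t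
    rise = Increasing-squeeze inc 3 (top-range 2 ≤-refl 2≤q)
             (≤-reflexive (trans (cong C 2+u≡q) (trans Cq≡n (cong suc (sym 2+u≡q)))))
    two : C (3 + u + 0) ≡ 2
    two = trans (cong C (trans (+-identityʳ (3 + u)) (cong suc 2+u≡q))) C[1+q]≡2
  ... | no Cq≢n | _ = from-block shape
    where
    Cq<n : C q < n
    Cq<n = ≤∧≢⇒< Cq≤n Cq≢n
    -- otherwise 3 < C q < n and P (C q) = 2 would be a valley after the 1 at 2
    Cq≡3 : C q ≡ 3
    Cq≡3 with C q ≟ 3
    ... | yes eq = eq
    ... | no  ne = ⊥-elim (no-valley-after-1 2 (s≤s z≤n) (≤-trans (s≤s (s≤s z≤n)) (s≤s 2≤q)) P2≡1 3 (C q) n ≤-refl 3<Cq Cq<n ≤-refl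
                     (subst (_< P 3) (sym P[Cq]≡2) (3≤P (s≤s z≤n) (≤-trans (s≤s 2≤q) ≤-refl) (λ ()) (λ eq → ne (sym eq))))
                     (subst (_< P n) (sym P[Cq]≡2) (3≤P (s≤s z≤n) ≤-refl (<⇒≢ (s≤s 2≤q) ∘ sym) (<⇒≢ Cq<n ∘ sym))))
      where
      3<Cq : 3 < C q
      3<Cq = ≤∧≢⇒< (top-range q 2≤q ≤-refl) (λ eq → ne (sym eq))
      3≤P : ∀ {x} → 1 ≤ x → x ≤ n → x ≢ 2 → x ≢ C q → 3 ≤ P x
      3≤P = P≢1,2⇒3≤P (s≤s z≤n) (s≤s (≤-trans (s≤s z≤n) 2≤q)) P2≡1 (proj₁ (C-range q 1≤q (n≤1+n q))) Cq≤n P[Cq]≡2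
    3≤q : 3 ≤ q
    3≤q = ≤∧≢⇒< 2≤q (λ 2≡q → Cq≢n (trans Cq≡3 (cong suc 2≡q)))
    q+2≡1+n : q + 2 ≡ suc n
    q+2≡1+n = +-comm q 2
    open Block cy 2 q ≤-refl 3≤q q<n q+2≡1+n Cq≡3 C[1+q]≡2 top-range top-onto P2≡1 using (Shape; shape)
    from-block : Shape → RightShape
    from-block (dd , u , _ , q≡ , n≡ , rise , fall) =
      dd , u , n≡ , record { rise = rise ; fall = fall ; two = subst (λ i → C (suc i) ≡ 2) q≡ C[1+q]≡2 ; tail = λ _ () }

∈-applyUpTo-bounds : ∀ {f c lo hi} → (∀ i → i < c → lo ≤ f i × f i ≤ hi) → ∀ {v} → v ∈ applyUpTo f c → lo ≤ v × v ≤ hi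
∈-applyUpTo-bounds {f} bounds v∈ with ∈-applyUpTo⁻ f v∈
... | i , i<c , refl = bounds i i<c

Unique-applyUpTo-+ : ∀ a c → Unique (applyUpTo (a +_) c)
Unique-applyUpTo-+ a c = Unique.applyUpTo⁺₁ (a +_) c (λ i<j _ eq → <⇒≢ i<j (+-cancelˡ-≡ a _ _ eq))

Unique-applyUpTo-∸ : ∀ a c → c ≤ a → Unique (applyUpTo (a ∸_) c)
Unique-applyUpTo-∸ a c c≤a = Unique.applyUpTo⁺₁ (a ∸_) c (λ i<j j<c eq → <⇒≢ (∸-monoʳ-< i<j (≤-trans (<⇒≤ j<c) c≤a)) (sym eq))

data CyclePosition (l dd u i : ℕ) : Set where
  at-head : i ≡ 1 → CyclePosition l dd u i
  at-rise : ∀ t → t ≤ u → i ≡ 2 + t → CyclePosition l dd u i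
  at-fall : ∀ s → s < dd → i ≡ 3 + u + s → CyclePosition l dd u i
  at-two  : i ≡ 3 + u + dd → CyclePosition l dd u i
  at-tail : ∀ t → t < l → i ≡ 4 + u + dd + t → CyclePosition l dd u i

cyclePosition : ∀ l dd u i → 1 ≤ i → i ≤ 3 + l + dd + u → CyclePosition l dd u i
cyclePosition l dd u 1 _ _ = at-head refl
cyclePosition l dd u (suc (suc i)) _ i≤n with i ≤? u
... | yes i≤u = at-rise i i≤u refl
... | no  i≰u with m≤n⇒∃[o]m+o≡n (≰⇒> i≰u)
...   | s , refl with <-cmp s dd
...     | tri< s<dd _ _ = at-fall s s<dd refl
...     | tri≈ _ refl _ = at-two refl
...     | tri> _ _ dd<s with m≤n⇒∃[o]m+o≡n dd<s
...       | t , refl with t <? l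
...         | yes t<l = at-tail t t<l (arith u dd t)
  where
  arith : ∀ u dd t → 2 + (suc u + (suc dd + t)) ≡ 4 + u + dd + t
  arith = solve-∀
...         | no  t≮l = ⊥-elim (<⇒≱ (≤-trans (≤-reflexive (arith₁ l dd u)) (+-monoʳ-≤ (4 + u + dd) (≮⇒≥ t≮l))) (subst (_≤ 3 + l + dd + u) (arith₂ u dd t) i≤n))
  where
  arith₁ : ∀ l dd u → suc (3 + l + dd + u) ≡ 4 + u + dd + l
  arith₁ = solve-∀
  arith₂ : ∀ u dd t → 2 + (suc u + (suc dd + t)) ≡ 4 + u + dd + t
  arith₂ = solve-∀

data LinePosition (l dd u x : ℕ) : Set where
  line-tail : ∀ t → t < l → x ≡ 2 + t → LinePosition l dd u x
  line-one  : x ≡ 2 + l → LinePosition l dd u x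
  line-mid  : ∀ s → s < dd → x ≡ 3 + l + s → LinePosition l dd u x
  line-rise : ∀ t → t < u → x ≡ 3 + l + dd + t → LinePosition l dd u x

linePosition : ∀ l dd u x → 2 ≤ x → x < 3 + l + dd + u → LinePosition l dd u x
linePosition l dd u 1 (s≤s ()) _
linePosition l dd u (suc (suc y)) _ x<size with <-cmp y l
... | tri< y<l _ _ = line-tail y y<l refl
... | tri≈ _ refl _ = line-one refl
... | tri> _ _ l<y with m≤n⇒∃[o]m+o≡n l<y
...   | s , refl with s <? dd
...     | yes s<dd = line-mid s s<dd refl
...     | no  s≮dd with m≤n⇒∃[o]m+o≡n (≮⇒≥ s≮dd)
...       | t , refl = line-rise t (+-cancelˡ-< (3 + l + dd) t u (subst (_< 3 + l + dd + u) x≡ x<size)) x≡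
  where
  x≡ : 2 + (suc l + (dd + t)) ≡ 3 + l + dd + t
  x≡ = cong (3 +_) (sym (+-assoc l dd t))

app-applyUpTo : ∀ f c t → t < c → app (applyUpTo f c) (suc t) ≡ f t
app-applyUpTo f (suc c) zero    _         = refl
app-applyUpTo f (suc c) (suc t) (s≤s t<c) = app-applyUpTo (f ∘ suc) c t t<c

midValue : ℕ → ℕ → ℕ
midValue l zero    = 2
midValue l (suc s) = 3 + l + s

module Family (l dd u : ℕ) where

  size : ℕ
  size = 3 + l + dd + u

  risePart fallPart tailPart midPart rise′Part : List ℕ
  risePart  = applyUpTo (λ t → 3 + l + dd + t) (suc u)
  fallPart  = applyUpTo (λ s → 2 + l + dd ∸ s) dd
  tailPart  = applyUpTo (3 +_) l
  midPart   = applyUpTo (midValue l) dd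
  rise′Part = applyUpTo (λ t → 4 + l + dd + t) u

  cycleList : List ℕ
  cycleList = 1 ∷ risePart ++ fallPart ++ 2 ∷ tailPart

  oneLine : List ℕ
  oneLine = 3 + l + dd ∷ tailPart ++ 1 ∷ midPart ++ rise′Part ++ 2 + l + dd ∷ []

  private
    length-risePart : length risePart ≡ suc u
    length-risePart = length-applyUpTo (λ t → 3 + l + dd + t) (suc u)
    length-fallPart : length fallPart ≡ dd
    length-fallPart = length-applyUpTo (λ s → 2 + l + dd ∸ s) dd
    length-tailPart : length tailPart ≡ l
    length-tailPart = length-applyUpTo (3 +_) l
    length-midPart : length midPart ≡ dd
    length-midPart = length-applyUpTo (midValue l) dd
    length-rise′Part : length rise′Part ≡ u
    length-rise′Part = length-applyUpTo (λ t → 4 + l + dd + t) u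

    skip : ∀ (xs ys : List ℕ) {c i} j → length xs ≡ c → j ≡ c + i → app (xs ++ ys) (suc j) ≡ app ys (suc i)
    skip xs ys {c} {i} j len j≡ = app-++ʳ xs ys j (trans j≡ (cong (_+ i) (sym len)))

    keep : ∀ (xs ys : List ℕ) {c} i → length xs ≡ c → i < c → app (xs ++ ys) (suc i) ≡ app xs (suc i)
    keep xs ys i len i<c = app-++ˡ xs ys i (subst (i <_) (sym len) i<c)

  length-cycleList : length cycleList ≡ size
  length-cycleList = begin
    suc (length (risePart ++ fallPart ++ 2 ∷ tailPart))
      ≡⟨ cong suc (length-++ risePart) ⟩
    suc (length risePart + length (fallPart ++ 2 ∷ tailPart))
      ≡⟨ cong₂ (λ a b → suc (a + b)) length-risePart (length-++ fallPart) ⟩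
    suc (suc u + (length fallPart + suc (length tailPart)))
      ≡⟨ cong₂ (λ a b → suc (suc u + (a + suc b))) length-fallPart length-tailPart ⟩
    suc (suc u + (dd + suc l))
      ≡⟨ arith l dd u ⟩
    size ∎
    where
    open ≡-Reasoning
    arith : ∀ l dd u → suc (suc u + (dd + suc l)) ≡ 3 + l + dd + u
    arith = solve-∀

  length-oneLine : length oneLine ≡ size
  length-oneLine = begin
    suc (length (tailPart ++ 1 ∷ midPart ++ rise′Part ++ 2 + l + dd ∷ []))
      ≡⟨ cong suc (length-++ tailPart) ⟩
    suc (length tailPart + suc (length (midPart ++ rise′Part ++ 2 + l + dd ∷ [])))
      ≡⟨ cong₂ (λ a b → suc (a + suc b)) length-tailPart (length-++ midPart) ⟩
    suc (l + suc (length midPart + length (rise′Part ++ 2 + l + dd ∷ [])))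
      ≡⟨ cong₂ (λ a b → suc (l + suc (a + b))) length-midPart (length-++ rise′Part) ⟩
    suc (l + suc (dd + (length rise′Part + 1)))
      ≡⟨ cong (λ a → suc (l + suc (dd + (a + 1)))) length-rise′Part ⟩
    suc (l + suc (dd + (u + 1)))
      ≡⟨ arith l dd u ⟩
    size ∎
    where
    open ≡-Reasoning
    arith : ∀ l dd u → suc (l + suc (dd + (u + 1))) ≡ 3 + l + dd + u
    arith = solve-∀

  cycleList-shape : CycleShape l dd u (app cycleList)
  cycleList-shape = record { rise = rise ; fall = fall ; two = two ; tail = tail }
    where
    rest = fallPart ++ 2 ∷ tailPart
    rise : ∀ t → t ≤ u → app cycleList (2 + t) ≡ 3 + l + dd + t
    rise t t≤u = trans (keep risePart rest t length-risePart (s≤s t≤u)) (app-applyUpTo (λ t → 3 + l + dd + t) (suc u) t (s≤s t≤u))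
    fall : ∀ s → s < dd → app cycleList (3 + u + s) + s ≡ 2 + l + dd
    fall s s<dd = trans (cong (_+ s) (begin
      app cycleList (3 + u + s)  ≡⟨ skip risePart rest (suc u + s) length-risePart refl ⟩
      app rest (suc s)           ≡⟨ keep fallPart (2 ∷ tailPart) s length-fallPart s<dd ⟩
      app fallPart (suc s)       ≡⟨ app-applyUpTo (λ s → 2 + l + dd ∸ s) dd s s<dd ⟩
      2 + l + dd ∸ s             ∎))
      (m∸n+n≡m (≤-trans (<⇒≤ s<dd) (m≤n+m dd (2 + l))))
      where open ≡-Reasoning
    two : app cycleList (3 + u + dd) ≡ 2
    two = trans (skip risePart rest (suc u + dd) length-risePart refl)
                (skip fallPart (2 ∷ tailPart) dd length-fallPart (sym (+-identityʳ dd)))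
    tail : ∀ t → t < l → app cycleList (4 + u + dd + t) ≡ 3 + t
    tail t t<l = begin
      app cycleList (4 + u + dd + t)  ≡⟨ skip risePart rest (suc (suc (u + dd + t))) length-risePart (arith u dd t) ⟩
      app rest (suc (dd + suc t))     ≡⟨ skip fallPart (2 ∷ tailPart) (dd + suc t) length-fallPart refl ⟩
      app tailPart (suc t)            ≡⟨ app-applyUpTo (3 +_) l t t<l ⟩
      3 + t                           ∎
      where
      open ≡-Reasoning
      arith : ∀ u dd t → suc (suc (u + dd + t)) ≡ suc u + (dd + suc t)
      arith = solve-∀

  private
    afterTail afterMid : List ℕ
    afterTail = 1 ∷ midPart ++ rise′Part ++ 2 + l + dd ∷ []
    afterMid = rise′Part ++ 2 + l + dd ∷ []

    skip-to-afterMid : ∀ {i} j → j ≡ l + suc (dd + i) → app oneLine (suc (suc j)) ≡ app afterMid (suc i)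
    skip-to-afterMid {i} j j≡ = trans (skip tailPart afterTail j length-tailPart j≡)
                                      (skip midPart afterMid (dd + i) length-midPart refl)

  oneLine-tail : ∀ t → t < l → app oneLine (2 + t) ≡ 3 + t
  oneLine-tail t t<l = trans (keep tailPart afterTail t length-tailPart t<l) (app-applyUpTo (3 +_) l t t<l)

  oneLine-one : app oneLine (2 + l) ≡ 1
  oneLine-one = skip tailPart afterTail l length-tailPart (sym (+-identityʳ l))

  oneLine-mid : ∀ s → s < dd → app oneLine (3 + l + s) ≡ midValue l s
  oneLine-mid s s<dd = begin
    app oneLine (3 + l + s)         ≡⟨ skip tailPart afterTail (suc (l + s)) length-tailPart (sym (+-suc l s)) ⟩
    app (midPart ++ afterMid) (suc s) ≡⟨ keep midPart afterMid s length-midPart s<dd ⟩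
    app midPart (suc s)             ≡⟨ app-applyUpTo (midValue l) dd s s<dd ⟩
    midValue l s                    ∎
    where open ≡-Reasoning

  oneLine-rise : ∀ t → t < u → app oneLine (3 + l + dd + t) ≡ 4 + l + dd + t
  oneLine-rise t t<u = begin
    app oneLine (3 + l + dd + t)  ≡⟨ skip-to-afterMid (suc (l + dd + t)) (arith l dd t) ⟩
    app afterMid (suc t)          ≡⟨ keep rise′Part (2 + l + dd ∷ []) t length-rise′Part t<u ⟩
    app rise′Part (suc t)         ≡⟨ app-applyUpTo (λ t → 4 + l + dd + t) u t t<u ⟩
    4 + l + dd + t                ∎
    where
    open ≡-Reasoning
    arith : ∀ l dd t → suc (l + dd + t) ≡ l + suc (dd + t)
    arith = solve-∀

  oneLine-last : app oneLine size ≡ 2 + l + dd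
  oneLine-last = trans (skip-to-afterMid (suc (l + dd + u)) (arith l dd u))
                       (skip rise′Part (2 + l + dd ∷ []) u length-rise′Part (sym (+-identityʳ u)))
    where
    arith : ∀ l dd u → suc (l + dd + u) ≡ l + suc (dd + u)
    arith = solve-∀

module _ (l dd u : ℕ) where
  open Family l dd u
  open CycleShape cycleList-shape

  private
    P C : ℕ → ℕ
    P = app oneLine
    C = app cycleList

  family-step-fall : ∀ s s′ → suc s + s′ ≡ dd → P (C (3 + u + s)) ≡ C (suc (3 + u + s))
  family-step-fall s s′ 1+s+s′≡dd = trans (cong P C≡) (trans (oneLine-mid s′ s′<dd) (value s′ refl))
    where
    s<dd : s < dd
    s<dd = subst (s <_) 1+s+s′≡dd (s≤s (m≤m+n s s′))
    s′<dd : s′ < dd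
    s′<dd = subst (s′ <_) 1+s+s′≡dd (s≤s (m≤n+m s′ s))
    C≡ : C (3 + u + s) ≡ 3 + l + s′
    C≡ = +-cancelʳ-≡ s _ _ (trans (fall s s<dd) (trans (cong (2 + l +_) (sym 1+s+s′≡dd)) (arith l s s′)))
      where
      arith : ∀ l s s′ → 2 + l + (suc s + s′) ≡ 3 + l + s′ + s
      arith = solve-∀
    value : ∀ s″ → s″ ≡ s′ → midValue l s″ ≡ C (suc (3 + u + s))
    value zero    0≡s′ = sym (trans (cong C (trans (arith u s) (cong (λ x → 3 + u + (suc s + x)) 0≡s′))) (trans (cong (λ d → C (3 + u + d)) 1+s+s′≡dd) two))
      where
      arith : ∀ u s → suc (3 + u + s) ≡ 3 + u + (suc s + 0)
      arith = solve-∀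
    value (suc s₃) 1+s₃≡s′ = sym (+-cancelʳ-≡ (suc s) _ _ (begin
      C (suc (3 + u + s)) + suc s  ≡⟨ cong (λ i → C i + suc s) (sym (+-suc (3 + u) s)) ⟩
      C (3 + u + suc s) + suc s    ≡⟨ fall (suc s) (subst (suc s <_) 1+s+s′≡dd (m<m+n (suc s) (subst (0 <_) 1+s₃≡s′ (s≤s z≤n)))) ⟩
      2 + l + dd                   ≡⟨ cong (2 + l +_) (trans (sym 1+s+s′≡dd) (cong (suc s +_) (sym 1+s₃≡s′))) ⟩
      2 + l + (suc s + suc s₃)     ≡⟨ arith l s s₃ ⟩
      3 + l + s₃ + suc s           ∎))
      where
      open ≡-Reasoning
      arith : ∀ l s s₃ → 2 + l + (suc s + suc s₃) ≡ 3 + l + s₃ + suc s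
      arith = solve-∀

  family-after-rise : (1 ≤ dd ⊎ l ≡ 0) → C (3 + u) ≡ 2 + l + dd
  family-after-rise valid with 1 ≤? dd
  ... | yes 1≤dd = trans (sym (trans (+-identityʳ _) (cong C (+-identityʳ (3 + u))))) (fall 0 1≤dd)
  ... | no  1≰dd with valid
  ...   | inj₁ 1≤dd = ⊥-elim (1≰dd 1≤dd)
  ...   | inj₂ l≡0  = trans (cong C (trans (sym (+-identityʳ (3 + u))) (cong (3 + u +_) (sym dd≡0))))
                            (trans two (cong₂ (λ a b → 2 + a + b) (sym l≡0) (sym dd≡0)))
    where
    dd≡0 : dd ≡ 0
    dd≡0 = n<1⇒n≡0 (≰⇒> 1≰dd)

  family-step : (1 ≤ dd ⊎ l ≡ 0) → ∀ i → 1 ≤ i → i < size → P (C i) ≡ C (suc i)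
  family-step valid i 1≤i i<size with cyclePosition l dd u i 1≤i (<⇒≤ i<size)
  ... | at-head refl = sym (trans (rise 0 z≤n) (+-identityʳ _))
  ... | at-rise t t≤u refl with t ≟ u
  ...   | yes refl = trans (cong P (rise t t≤u)) (trans oneLine-last (sym (family-after-rise valid)))
  ...   | no  t≢u  = trans (cong P (rise t t≤u))
                           (trans (oneLine-rise t (≤∧≢⇒< t≤u t≢u)) (sym (trans (rise (suc t) (≤∧≢⇒< t≤u t≢u)) (+-suc (3 + l + dd) t))))
  family-step valid i 1≤i i<size | at-fall s s<dd refl with m≤n⇒∃[o]m+o≡n s<dd
  ... | s′ , 1+s+s′≡dd = family-step-fall s s′ 1+s+s′≡dd
  family-step valid i 1≤i i<size | at-two refl =
    trans (cong P two) (trans (oneLine-tail 0 0<l) (sym (trans (cong C (sym (+-identityʳ (4 + u + dd)))) (tail 0 0<l))))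
    where
    arith : ∀ l dd u → 3 + l + dd + u ≡ 3 + u + dd + l
    arith = solve-∀
    0<l : 0 < l
    0<l = +-cancelˡ-< (3 + u + dd) 0 l (subst₂ _<_ (sym (+-identityʳ _)) (arith l dd u) i<size)
  family-step valid i 1≤i i<size | at-tail t t<l refl =
    trans (cong P (tail t t<l)) (trans (oneLine-tail (suc t) 1+t<l) (sym (trans (cong C (sym (+-suc (4 + u + dd) t))) (tail (suc t) 1+t<l))))
    where
    arith₁ : ∀ u dd t → suc (4 + u + dd + t) ≡ 3 + u + dd + suc (suc t)
    arith₁ = solve-∀
    arith₂ : ∀ l dd u → 3 + l + dd + u ≡ 3 + u + dd + l
    arith₂ = solve-∀
    1+t<l : suc t < l
    1+t<l = +-cancelˡ-≤ (3 + u + dd) (suc (suc t)) l (subst₂ _≤_ (arith₁ u dd t) (arith₂ l dd u) i<size)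

  family-closes : P (C size) ≡ 1
  family-closes with l ≟ 0
  ... | yes l≡0 = trans (cong P (trans (cong C (trans (cong (λ a → 3 + a + dd + u) l≡0) (arith dd u)))
                                       (trans two (cong (2 +_) (sym l≡0)))))
                        oneLine-one
    where
    arith : ∀ dd u → 3 + 0 + dd + u ≡ 3 + u + dd
    arith = solve-∀
  ... | no l≢0 with m≤n⇒∃[o]m+o≡n (n≢0⇒n>0 l≢0)
  ...   | l′ , 1+l′≡l = trans (cong P (trans (cong C (trans (cong (λ a → 3 + a + dd + u) (sym 1+l′≡l)) (arith l′ dd u)))
                                             (trans (tail l′ (subst (l′ <_) 1+l′≡l ≤-refl)) (cong (2 +_) 1+l′≡l))))
                              oneLine-one
    where
    arith : ∀ l′ dd u → 3 + suc l′ + dd + u ≡ 4 + u + dd + l′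
    arith = solve-∀

  private
    rise-bounds : ∀ {v} → v ∈ risePart → 3 + l + dd ≤ v × v ≤ size
    rise-bounds = ∈-applyUpTo-bounds λ t t<1+u →
      m≤m+n (3 + l + dd) t , +-monoʳ-≤ (3 + l + dd) (≤-pred t<1+u)

    fall-bounds : ∀ {v} → v ∈ fallPart → 3 + l ≤ v × v ≤ 2 + l + dd
    fall-bounds = ∈-applyUpTo-bounds λ s s<dd →
      m+n≤o⇒m≤o∸n (3 + l) (subst (_≤ 2 + l + dd) (+-suc (2 + l) s) (+-monoʳ-≤ (2 + l) s<dd)) , m∸n≤m _ s

    tail-bounds : ∀ {v} → v ∈ tailPart → 3 ≤ v × v ≤ 2 + l
    tail-bounds = ∈-applyUpTo-bounds λ t t<l → m≤m+n 3 t , +-monoʳ-≤ 2 t<l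

    2+l+dd≤size : 2 + l + dd ≤ size
    2+l+dd≤size = ≤-trans (n≤1+n _) (m≤m+n (3 + l + dd) u)

    2+l≤2+l+dd : 2 + l ≤ 2 + l + dd
    2+l≤2+l+dd = m≤m+n (2 + l) dd

  cycleList-range : All (_∈ range size) cycleList
  cycleList-range = ∈-range⁺ ≤-refl (s≤s z≤n)
    ∷ All.++⁺ (All.tabulate λ v∈ → ∈-range⁺ (≤-trans (s≤s z≤n) (proj₁ (rise-bounds v∈))) (proj₂ (rise-bounds v∈)))
      (All.++⁺ (All.tabulate λ v∈ → ∈-range⁺ (≤-trans (s≤s z≤n) (proj₁ (fall-bounds v∈))) (≤-trans (proj₂ (fall-bounds v∈)) 2+l+dd≤size))
               (∈-range⁺ (s≤s z≤n) (s≤s (s≤s z≤n))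
                ∷ All.tabulate λ v∈ → ∈-range⁺ (≤-trans (s≤s z≤n) (proj₁ (tail-bounds v∈)))
                                                (≤-trans (proj₂ (tail-bounds v∈)) (≤-trans 2+l≤2+l+dd 2+l+dd≤size))))

  Unique-cycleList : Unique cycleList
  Unique-cycleList = All.tabulate (λ v∈ 1≡v → <⇒≢ (2≤rest v∈) 1≡v)
                   ∷ Unique.++⁺ (Unique-applyUpTo-+ (3 + l + dd) (suc u)) unique-lower
                       (λ (v∈rise , v∈lower) → <⇒≱ (s≤s (lower≤ v∈lower)) (proj₁ (rise-bounds v∈rise)))
    where
    unique-lower : Unique (fallPart ++ 2 ∷ tailPart)
    unique-lower = Unique.++⁺ (Unique-applyUpTo-∸ (2 + l + dd) dd (m≤n+m dd (2 + l)))
                     (All.tabulate (λ v∈ 2≡v → <⇒≢ (proj₁ (tail-bounds v∈)) 2≡v) ∷ Unique-applyUpTo-+ 3 l)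
                     λ { (v∈fall , here refl) → <⇒≱ (s≤s (s≤s (s≤s z≤n))) (proj₁ (fall-bounds v∈fall))
                       ; (v∈fall , there v∈tail) → <⇒≱ (s≤s (proj₂ (tail-bounds v∈tail))) (proj₁ (fall-bounds v∈fall)) }
    lower≤ : ∀ {v} → v ∈ fallPart ++ 2 ∷ tailPart → v ≤ 2 + l + dd
    lower≤ v∈ with ∈-++⁻ fallPart v∈
    ... | inj₁ v∈fall = proj₂ (fall-bounds v∈fall)
    ... | inj₂ (here refl) = ≤-trans (s≤s (s≤s z≤n)) 2+l≤2+l+dd
    ... | inj₂ (there v∈tail) = ≤-trans (proj₂ (tail-bounds v∈tail)) 2+l≤2+l+dd
    2≤rest : ∀ {v} → v ∈ risePart ++ fallPart ++ 2 ∷ tailPart → 2 ≤ v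
    2≤rest v∈ with ∈-++⁻ risePart v∈
    ... | inj₁ v∈rise = ≤-trans (s≤s (s≤s z≤n)) (proj₁ (rise-bounds v∈rise))
    ... | inj₂ v∈lower with ∈-++⁻ fallPart v∈lower
    ...   | inj₁ v∈fall = ≤-trans (s≤s (s≤s z≤n)) (proj₁ (fall-bounds v∈fall))
    ...   | inj₂ (here refl) = ≤-refl
    ...   | inj₂ (there v∈tail) = ≤-trans (s≤s (s≤s z≤n)) (proj₁ (tail-bounds v∈tail))

  private
    C-lookup : ∀ i → 1 ≤ i → i ≤ size → C i ∈ range size
    C-lookup (suc i) _ i<size = All.lookup cycleList-range (app-∈ cycleList i (subst (i <_) (sym length-cycleList) i<size))

    2≤C : ∀ i → 2 ≤ i → i ≤ size → 2 ≤ C i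
    2≤C (suc i) (s≤s 1≤i) i<size = ≤∧≢⇒< (proj₁ (∈-range⁻ (C-lookup (suc i) (s≤s z≤n) i<size)))
      λ 1≡Ci → <⇒≢ 1≤i (sym (Unique⇒app-injective cycleList Unique-cycleList i 0
                                (subst (i <_) (sym length-cycleList) i<size) (subst (0 <_) (sym length-cycleList) (s≤s z≤n)) (sym 1≡Ci)))

    fall-lower : ∀ s → s < dd → 3 + l ≤ C (3 + u + s)
    fall-lower s s<dd = +-cancelʳ-≤ s (3 + l) _ (subst (3 + l + s ≤_) (sym (fall s s<dd))
                                                      (subst (_≤ 2 + l + dd) (+-suc (2 + l) s) (+-monoʳ-≤ (2 + l) s<dd)))

    fall-upper : ∀ s → s < dd → C (3 + u + s) ≤ 2 + l + dd
    fall-upper s s<dd = subst (C (3 + u + s) ≤_) (fall s s<dd) (m≤m+n _ s)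

  cycleList-no-213 : ∀ a b c → 1 ≤ a → a < b → b < c → c ≤ size → C b < C a → C a < C c → ⊥
  cycleList-no-213 a b c 1≤a a<b b<c c≤size Cb<Ca Ca<Cc with cyclePosition l dd u a 1≤a (≤-trans (<⇒≤ (<-trans a<b b<c)) c≤size)
  ... | at-head refl = <⇒≱ Cb<Ca (≤-trans (s≤s z≤n) (2≤C b a<b (≤-trans (<⇒≤ b<c) c≤size)))
  ... | at-two  refl = <⇒≱ (subst (C b <_) two Cb<Ca) (2≤C b (≤-trans (s≤s (s≤s z≤n)) a<b) (≤-trans (<⇒≤ b<c) c≤size))
  ... | at-rise t t≤u refl with cyclePosition l dd u c (≤-trans (s≤s z≤n) (<-trans a<b b<c)) c≤size
  ...   | at-head refl = <⇒≱ (<-trans a<b b<c) (s≤s z≤n)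
  ...   | at-rise t′ t′≤u refl with m≤n⇒∃[o]m+o≡n (≤-trans (s≤s (s≤s z≤n)) (<⇒≤ a<b))
  ...     | tb , refl = <⇒≱ (subst₂ _<_ (rise tb (≤-trans (<⇒≤ (+-cancelˡ-< 2 tb t′ b<c)) t′≤u)) (rise t t≤u) Cb<Ca)
                             (+-monoʳ-≤ (3 + l + dd) (<⇒≤ (+-cancelˡ-< 2 t tb a<b)))
  cycleList-no-213 a b c 1≤a a<b b<c c≤size Cb<Ca Ca<Cc | at-rise t t≤u refl | at-fall s s<dd refl =
    <⇒≱ Ca<Cc (≤-trans (fall-upper s s<dd) (≤-trans (n≤1+n _) (≤-trans (m≤m+n (3 + l + dd) t) (≤-reflexive (sym (rise t t≤u))))))
  cycleList-no-213 a b c 1≤a a<b b<c c≤size Cb<Ca Ca<Cc | at-rise t t≤u refl | at-two refl =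
    <⇒≱ Ca<Cc (≤-trans (≤-reflexive two) (≤-trans (s≤s (s≤s z≤n)) (≤-trans (m≤m+n (3 + l + dd) t) (≤-reflexive (sym (rise t t≤u))))))
  cycleList-no-213 a b c 1≤a a<b b<c c≤size Cb<Ca Ca<Cc | at-rise t t≤u refl | at-tail t′ t′<l refl =
    <⇒≱ Ca<Cc (≤-trans (≤-reflexive (tail t′ t′<l))
                        (≤-trans (+-monoʳ-≤ 3 (≤-trans (<⇒≤ t′<l) (≤-trans (m≤m+n l dd) (m≤m+n (l + dd) t)))) (≤-reflexive (sym (rise t t≤u)))))
  cycleList-no-213 a b c 1≤a a<b b<c c≤size Cb<Ca Ca<Cc | at-fall s s<dd refl
    with cyclePosition l dd u c (≤-trans (s≤s z≤n) (<-trans a<b b<c)) c≤size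
  ... | at-head refl = <⇒≱ (<-trans a<b b<c) (s≤s z≤n)
  ... | at-rise t′ t′≤u refl = <⇒≱ (<-trans a<b b<c) (≤-trans (s≤s (s≤s t′≤u)) (≤-trans (n≤1+n _) (m≤m+n (3 + u) s)))
  ... | at-fall s′ s′<dd refl =
    <⇒≱ Ca<Cc (+-cancelʳ-≤ s _ _ (≤-trans (+-monoʳ-≤ (C (3 + u + s′)) (<⇒≤ s<s′)) (≤-reflexive (trans (fall s′ s′<dd) (sym (fall s s<dd))))))
    where
    s<s′ : s < s′
    s<s′ = +-cancelˡ-< (3 + u) s s′ (<-trans a<b b<c)
  ... | at-two refl = <⇒≱ Ca<Cc (≤-trans (≤-reflexive two) (≤-trans (s≤s (s≤s z≤n)) (fall-lower s s<dd)))
  ... | at-tail t′ t′<l refl = <⇒≱ Ca<Cc (≤-trans (≤-reflexive (tail t′ t′<l)) (≤-trans (<⇒≤ (+-monoʳ-< 3 t′<l)) (fall-lower s s<dd)))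
  cycleList-no-213 a b c 1≤a a<b b<c c≤size Cb<Ca Ca<Cc | at-tail t t<l refl
    with cyclePosition l dd u b (≤-trans (s≤s z≤n) a<b) (≤-trans (<⇒≤ b<c) c≤size)
  ... | at-head refl = <⇒≱ a<b (s≤s z≤n)
  ... | at-rise tb tb≤u refl = <⇒≱ a<b (≤-trans (s≤s (s≤s tb≤u)) (≤-trans (≤-trans (n≤1+n (2 + u)) (≤-trans (n≤1+n (3 + u)) (m≤m+n (4 + u) dd))) (m≤m+n (4 + u + dd) t)))
  ... | at-fall sb sb<dd refl = <⇒≱ a<b (≤-trans (<⇒≤ (+-monoʳ-< (3 + u) sb<dd)) (≤-trans (n≤1+n _) (m≤m+n (4 + u + dd) t)))
  ... | at-two refl = <⇒≱ a<b (≤-trans (n≤1+n _) (m≤m+n (4 + u + dd) t))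
  ... | at-tail tb tb<l refl = <⇒≱ Cb<Ca (≤-trans (≤-reflexive (tail t t<l))
                                           (≤-trans (<⇒≤ (+-monoʳ-< 3 (+-cancelˡ-< (4 + u + dd) t tb a<b))) (≤-reflexive (sym (tail tb tb<l)))))

  private
    LargeValue : ℕ → Set
    LargeValue x = (P x ≡ suc x × x ≤ suc l) ⊎ (suc (P x) ≡ x × 4 + l ≤ x × x ≤ 2 + l + dd) ⊎ (P x ≡ suc x × 3 + l + dd ≤ x)

    large-value : ∀ x → 2 ≤ x → x < size → 3 ≤ P x → LargeValue x
    large-value x 2≤x x<size 3≤Px with linePosition l dd u x 2≤x x<size
    ... | line-tail t t<l refl = inj₁ (oneLine-tail t t<l , s≤s t<l)
    ... | line-one refl = ⊥-elim (<⇒≱ 3≤Px (≤-trans (≤-reflexive oneLine-one) (s≤s z≤n)))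
    ... | line-mid zero 0<dd refl = ⊥-elim (<⇒≱ 3≤Px (≤-reflexive (oneLine-mid 0 0<dd)))
    ... | line-mid (suc s) s<dd refl = inj₂ (inj₁ (trans (cong suc (oneLine-mid (suc s) s<dd)) (sym (+-suc (3 + l) s)) ,
                                                  subst (4 + l ≤_) (sym (+-suc (3 + l) s)) (s≤s (m≤m+n (3 + l) s)) ,
                                                  subst (_≤ 2 + l + dd) (+-suc (2 + l) (suc s)) (+-monoʳ-≤ (2 + l) s<dd)))
    ... | line-rise t t<u refl = inj₂ (inj₂ (oneLine-rise t t<u , m≤m+n (3 + l + dd) t))

    large-increasing : ∀ a b → 2 ≤ a → a < b → b < size → 3 ≤ P a → 3 ≤ P b → P a < P b
    large-increasing a b 2≤a a<b b<size 3≤Pa 3≤Pb with large-value a 2≤a (<-trans a<b b<size) 3≤Pa | large-value b (≤-trans 2≤a (<⇒≤ a<b)) b<size 3≤Pb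
    ... | inj₁ (Pa≡ , _)          | inj₁ (Pb≡ , _)               = subst₂ _<_ (sym Pa≡) (sym Pb≡) (s≤s a<b)
    ... | inj₁ (Pa≡ , a≤)         | inj₂ (inj₁ (Pb≡ , 4+l≤b , _)) = subst (_< P b) (sym Pa≡) (≤-trans (s≤s (s≤s a≤)) (≤-pred (subst (4 + l ≤_) (sym Pb≡) 4+l≤b)))
    ... | inj₁ (Pa≡ , _)          | inj₂ (inj₂ (Pb≡ , _))        = subst₂ _<_ (sym Pa≡) (sym Pb≡) (s≤s a<b)
    ... | inj₂ (inj₁ (_ , 4+l≤a , _)) | inj₁ (_ , b≤)            = ⊥-elim (<⇒≱ (≤-trans a<b b≤) (≤-trans (m≤n+m (1 + l) 3) 4+l≤a))
    ... | inj₂ (inj₁ (Pa≡ , _ , _)) | inj₂ (inj₁ (Pb≡ , _ , _))  = ≤-pred (subst₂ _<_ (sym Pa≡) (sym Pb≡) a<b)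
    ... | inj₂ (inj₁ (Pa≡ , _ , _)) | inj₂ (inj₂ (Pb≡ , _))      = subst (P a <_) (sym Pb≡) (<-trans (subst (P a <_) Pa≡ (n<1+n (P a))) (<-trans a<b (n<1+n b)))
    ... | inj₂ (inj₂ (_ , a≥))      | inj₁ (_ , b≤)              = ⊥-elim (<⇒≱ (≤-trans a<b b≤) (≤-trans (≤-trans (m≤n+m (1 + l) 2) (m≤m+n (3 + l) dd)) a≥))
    ... | inj₂ (inj₂ (_ , a≥))      | inj₂ (inj₁ (_ , _ , b≤))   = ⊥-elim (<⇒≱ (≤-trans a<b b≤) (≤-trans (n≤1+n _) a≥))
    ... | inj₂ (inj₂ (Pa≡ , _))     | inj₂ (inj₂ (Pb≡ , _))      = subst₂ _<_ (sym Pa≡) (sym Pb≡) (s≤s a<b)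

  module _ (valid : 1 ≤ dd ⊎ l ≡ 0) where

    private
      chain : ∀ i → suc i < size → P (C (suc i)) ≡ C (suc (suc i))
      chain i 1+i<size = family-step valid (suc i) (s≤s z≤n) 1+i<size

    open CycleList size oneLine cycleList (s≤s z≤n) length-oneLine length-cycleList Unique-cycleList cycleList-range refl chain family-closes
      renaming (∈perms to family-∈perms; cycleForm≡ to family-cycleForm)
      public

    private
      Unique-oneLine : Unique oneLine
      Unique-oneLine = proj₂ (proj₂ (∈perms⁻ size family-∈perms))

      1≤P : ∀ x → 1 ≤ x → x ≤ size → 1 ≤ P x
      1≤P (suc x) _ x<size = proj₁ (∈-range⁻ (All.lookup (proj₁ (proj₂ (∈perms⁻ size family-∈perms)))
                                                           (app-∈ oneLine x (subst (x <_) (sym length-oneLine) x<size))))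

      P-injective : ∀ x y → 1 ≤ x → x ≤ size → 1 ≤ y → y ≤ size → P x ≡ P y → x ≡ y
      P-injective (suc x) (suc y) _ x<size _ y<size eq =
        cong suc (Unique⇒app-injective oneLine Unique-oneLine x y (subst (x <_) (sym length-oneLine) x<size)
                                                                  (subst (y <_) (sym length-oneLine) y<size) eq)

      -- the entries 1 and 2 sit at the adjacent positions 2 + l and 3 + l, and the other entries before the last are increasing
      oneLine-prefix-no-132 : ∀ x y z → 1 ≤ x → x < y → y < z → z < length oneLine → P x < P z → P z < P y → ⊥
      oneLine-prefix-no-132 x y z 1≤x x<y y<z z<len Px<Pz Pz<Py with 3 ≤? P z | subst (z <_) length-oneLine z<len
      ... | yes 3≤Pz | z<size = <-asym Pz<Py (large-increasing y z (≤-trans (s≤s 1≤x) x<y) y<z z<size (≤-trans 3≤Pz (<⇒≤ Pz<Py)) 3≤Pz)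
      ... | no  3≰Pz | z<size with linePosition l dd u z (≤-trans (s≤s 1≤x) (<-trans x<y y<z)) z<size
      ...   | line-tail t t<l refl = 3≰Pz (≤-trans (m≤m+n 3 t) (≤-reflexive (sym (oneLine-tail t t<l))))
      ...   | line-one refl = <⇒≱ Px<Pz (subst (_≤ P x) (sym oneLine-one) (1≤P x 1≤x (<⇒≤ (<-trans (<-trans x<y y<z) z<size))))
      ...   | line-mid (suc s) s<dd refl = 3≰Pz (≤-trans (s≤s (s≤s (s≤s z≤n))) (≤-reflexive (sym (oneLine-mid (suc s) s<dd))))
      ...   | line-rise t t<u refl = 3≰Pz (≤-trans (s≤s (s≤s (s≤s z≤n))) (≤-reflexive (sym (oneLine-rise t t<u))))
      ...   | line-mid zero 0<dd refl = <⇒≱ (≤-trans (s≤s x<y) y<z) (≤-reflexive (trans (+-identityʳ (3 + l)) (cong suc (sym x≡))))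
        where
        Px≡1 : P x ≡ 1
        x≤size = <⇒≤ (<-trans (<-trans x<y y<z) z<size)
        Px≡1 = ≤-antisym (≤-pred (subst (P x <_) (oneLine-mid 0 0<dd) Px<Pz)) (1≤P x 1≤x x≤size)
        x≡ : x ≡ 2 + l
        x≡ = P-injective x (2 + l) 1≤x x≤size (s≤s z≤n) (≤-trans (n≤1+n _) (≤-trans (m≤m+n (3 + l) dd) (m≤m+n (3 + l + dd) u)))
                         (trans Px≡1 (sym oneLine-one))

    family-∈A : oneLine ∈ A size
    family-∈A = ∈-filter⁺ (λ π → T? (inA π)) family-∈perms
      (inA⁺ oneLine
        (subst (T ∘ distinct) (sym family-cycleForm) (Unique⇒distinct cycleList Unique-cycleList))
        (avoids-1324⁺ oneLine Unique-oneLine oneLine-prefix-no-132)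
        (avoids-1423⁺ oneLine Unique-oneLine oneLine-prefix-no-132)
        (subst (λ w → T (avoids w (2 ∷ 1 ∷ 3 ∷ []))) (sym family-cycleForm)
          (avoids-213⁺ cycleList Unique-cycleList λ a b c 1≤a a<b b<c c≤len →
            cycleList-no-213 a b c 1≤a a<b b<c (subst (c ≤_) length-cycleList c≤len))))

CycleShape-≡ : ∀ {l dd u C C′} → CycleShape l dd u C → CycleShape l dd u C′ → C 1 ≡ 1 → C′ 1 ≡ 1 →
               ∀ i → 1 ≤ i → i ≤ 3 + l + dd + u → C i ≡ C′ i
CycleShape-≡ {l} {dd} {u} shape shape′ C1 C′1 i 1≤i i≤n with cyclePosition l dd u i 1≤i i≤n
... | at-head refl       = trans C1 (sym C′1)
... | at-rise t t≤u refl = trans (CycleShape.rise shape t t≤u) (sym (CycleShape.rise shape′ t t≤u))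
... | at-fall s s<dd refl = +-cancelʳ-≡ s _ _ (trans (CycleShape.fall shape s s<dd) (sym (CycleShape.fall shape′ s s<dd)))
... | at-two refl        = trans (CycleShape.two shape) (sym (CycleShape.two shape′))
... | at-tail t t<l refl = trans (CycleShape.tail shape t t<l) (sym (CycleShape.tail shape′ t t<l))

InA-cycle-determines-perm : ∀ {n P C P′ C′} → InA n P C → InA n P′ C′ → (∀ i → 1 ≤ i → i ≤ n → C i ≡ C′ i) →
                            ∀ x → 1 ≤ x → x ≤ n → P x ≡ P′ x
InA-cycle-determines-perm {n} {P} {C} {P′} {C′} cy cy′ C≡C′ x 1≤x x≤n with InA.C-surjective cy x 1≤x x≤n
... | i , 1≤i , i≤n , refl with i ≟ n
...   | yes refl = trans (InA.P-last cy) (sym (trans (cong P′ (C≡C′ i 1≤i i≤n)) (InA.P-last cy′)))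
...   | no  i≢n  = begin
  P (C i)        ≡⟨ InA.P-step cy i 1≤i i<n ⟩
  C (suc i)      ≡⟨ C≡C′ (suc i) (s≤s z≤n) i<n ⟩
  C′ (suc i)     ≡⟨ InA.P-step cy′ i 1≤i i<n ⟨
  P′ (C′ i)      ≡⟨ cong P′ (C≡C′ i 1≤i i≤n) ⟨
  P′ (C i)       ∎
  where
  open ≡-Reasoning
  i<n = ≤∧≢⇒< i≤n i≢n

≡-family : ∀ l dd u π → (1 ≤ dd ⊎ l ≡ 0) → π ∈ A (3 + l + dd + u) → CycleShape l dd u (c π) →
           π ≡ Family.oneLine l dd u
≡-family l dd u π valid π∈ shape =
  app-ext π oneLine (trans (length-∈A size π∈) (sym length-oneLine)) λ i i< →
    InA-cycle-determines-perm cy cy-family cycles-agree (suc i) (s≤s z≤n) (subst (i <_) length-oneLine i<)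
  where
  open Family l dd u
  cy = ∈A⇒InA size π (s≤s z≤n) π∈
  cy-family = ∈A⇒InA size oneLine (s≤s z≤n) (family-∈A l dd u valid)
  family-shape : CycleShape l dd u (c oneLine)
  family-shape = subst (λ w → CycleShape l dd u (app w)) (sym (family-cycleForm l dd u valid)) cycleList-shape
  cycles-agree : ∀ i → 1 ≤ i → i ≤ size → c π i ≡ c oneLine i
  cycles-agree = CycleShape-≡ shape family-shape (InA.C-1 cy) (InA.C-1 cy-family)

Unique-⇔⇒length≡ : ∀ {xs ys : List (List ℕ)} → Unique xs → Unique ys →
                   (∀ {x} → x ∈ xs → x ∈ ys) → (∀ {x} → x ∈ ys → x ∈ xs) → length xs ≡ length ys
Unique-⇔⇒length≡ uxs uys xs⊆ys ys⊆xs = ↭-length (∼bag⇒↭ (unique∧set⇒bag uxs uys (mk⇔ xs⊆ys ys⊆xs)))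

length≡-by-parametrisation : ∀ {xs : List (List ℕ)} (f : ℕ → List ℕ) k → Unique xs → (∀ {d d′} → f d ≡ f d′ → d ≡ d′) →
                             (∀ {x} → x ∈ xs → ∃ λ d → d < k × x ≡ f d) → (∀ d → d < k → f d ∈ xs) → length xs ≡ k
length≡-by-parametrisation f k unique f-injective param f∈ = begin
  length xs                  ≡⟨ Unique-⇔⇒length≡ unique (Unique.map⁺ f-injective (Unique.upTo⁺ k)) xs⊆ ⊆xs ⟩
  length (map f (upTo k))    ≡⟨ length-map f (upTo k) ⟩
  length (upTo k)            ≡⟨ length-upTo k ⟩
  k                          ∎
  where
  open ≡-Reasoning
  xs = _
  xs⊆ : ∀ {x} → x ∈ xs → x ∈ map f (upTo k)
  xs⊆ x∈ with param x∈
  ... | d , d<k , refl = ∈-map⁺ f (∈-upTo⁺ d<k)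
  ⊆xs : ∀ {x} → x ∈ map f (upTo k) → x ∈ xs
  ⊆xs x∈ with ∈-map⁻ f x∈
  ... | d , d∈ , refl = f∈ d (∈-upTo⁻ d∈)

Unique-A : ∀ n → Unique (A n)
Unique-A n = Unique.filter⁺ _ (Unique.filter⁺ _ (Unique-words (range n) n (Unique-range n)))

c-family : ∀ l dd u → (1 ≤ dd ⊎ l ≡ 0) → ∀ i → c (Family.oneLine l dd u) i ≡ app (Family.cycleList l dd u) i
c-family l dd u valid i = cong (λ w → app w i) (family-cycleForm l dd u valid)

leftFamily : ℕ → ℕ → ℕ → List ℕ
leftFamily n q′ d = Family.oneLine (n ∸ (4 + q′)) (suc d) (q′ ∸ d)

rightFamily : ℕ → ℕ → List ℕ
rightFamily q′ d = Family.oneLine 0 d (q′ ∸ d)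

∈A⁻∣2⁻ : ∀ n r {π} → π ∈ A⁻∣2 n r → π ∈ A n × c π r ≡ 2 × c π (r ∸ 1) ≢ n
∈A⁻∣2⁻ n r {π} π∈ = π∈A , ≡ᵇ⇒≡ (c π r) 2 (proj₁ conds) , λ eq → T-not {c π (r ∸ 1) ≡ᵇ n} (proj₂ conds) (≡⇒≡ᵇ (c π (r ∸ 1)) n eq)
  where
  decoded = ∈-filter⁻ (λ π → T? ((c π r ≡ᵇ 2) ∧ not (c π (r ∸ 1) ≡ᵇ n))) {xs = A n} π∈
  π∈A = proj₁ decoded
  conds = T-∧⁻ (c π r ≡ᵇ 2) (not (c π (r ∸ 1) ≡ᵇ n)) (proj₂ decoded)

∈A⁻∣2⁺ : ∀ n r {π} → π ∈ A n → c π r ≡ 2 → c π (r ∸ 1) ≢ n → π ∈ A⁻∣2 n r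
∈A⁻∣2⁺ n r {π} π∈A Cr≡2 Cr-1≢n =
  ∈-filter⁺ (λ π → T? ((c π r ≡ᵇ 2) ∧ not (c π (r ∸ 1) ≡ᵇ n))) π∈A
    (T-∧⁺ (c π r ≡ᵇ 2) (not (c π (r ∸ 1) ≡ᵇ n)) (≡⇒≡ᵇ (c π r) 2 Cr≡2) (not-T (λ t → Cr-1≢n (≡ᵇ⇒≡ (c π (r ∸ 1)) n t))))

∈A∣2⁻ : ∀ n j {π} → π ∈ A∣2 n j → π ∈ A n × c π j ≡ 2
∈A∣2⁻ n j {π} π∈ = proj₁ decoded , ≡ᵇ⇒≡ (c π j) 2 (proj₂ decoded)
  where decoded = ∈-filter⁻ (λ π → T? (c π j ≡ᵇ 2)) {xs = A n} π∈

∈A∣2⁺ : ∀ n j {π} → π ∈ A n → c π j ≡ 2 → π ∈ A∣2 n j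
∈A∣2⁺ n j {π} π∈A Cj≡2 = ∈-filter⁺ (λ π → T? (c π j ≡ᵇ 2)) π∈A (≡⇒≡ᵇ (c π j) 2 Cj≡2)

∈A⁻∣2⇒leftFamily : ∀ n q′ {π} → 4 + q′ < n → π ∈ A⁻∣2 n (4 + q′) → ∃ λ d → d < suc q′ × π ≡ leftFamily n q′ d
∈A⁻∣2⇒leftFamily n q′ {π} r<n π∈ = from-shape (LeftAnalysis.left-shape cy (3 + q′) (s≤s (s≤s (s≤s z≤n))) r<n Cr≡2 Cq≢n)
  where
  decoded = ∈A⁻∣2⁻ n (4 + q′) π∈
  π∈A = proj₁ decoded
  Cr≡2 = proj₁ (proj₂ decoded)
  Cq≢n = proj₂ (proj₂ decoded)
  cy = ∈A⇒InA n π (≤-trans (s≤s z≤n) r<n) π∈A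
  from-shape : (∃ λ l → ∃ λ dd → ∃ λ u → 1 ≤ dd × n ≡ 3 + l + dd + u × 3 + q′ ≡ 2 + u + dd × CycleShape l dd u (c π)) →
               ∃ λ d → d < suc q′ × π ≡ leftFamily n q′ d
  from-shape (l , suc d , u , _ , n≡ , q≡ , shape) =
    d , d<1+q′ , trans (≡-family l (suc d) u π (inj₁ (s≤s z≤n)) (subst (λ m → π ∈ A m) n≡ π∈A) shape)
                       (cong₂ (λ l′ u′ → Family.oneLine l′ (suc d) u′) (sym l≡) (sym u≡))
    where
    q′≡ : q′ ≡ u + d
    q′≡ = suc-injective (suc-injective (suc-injective (trans q≡ (arith u d))))
      where
      arith : ∀ u d → 2 + u + suc d ≡ 3 + (u + d)
      arith = solve-∀
    d<1+q′ : d < suc q′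
    d<1+q′ = s≤s (subst (d ≤_) (sym q′≡) (m≤n+m d u))
    u≡ : q′ ∸ d ≡ u
    u≡ = trans (cong (_∸ d) q′≡) (m+n∸n≡m u d)
    l≡ : n ∸ (4 + q′) ≡ l
    l≡ = trans (cong₂ (λ x y → x ∸ (4 + y)) n≡ q′≡) (trans (cong (_∸ (4 + (u + d))) (arith l d u)) (m+n∸m≡n (4 + (u + d)) l))
      where
      arith : ∀ l d u → 3 + l + suc d + u ≡ 4 + (u + d) + l
      arith = solve-∀

∈A∣2⇒rightFamily : ∀ q′ {π} → π ∈ A∣2 (3 + q′) (3 + q′) → ∃ λ d → d < suc q′ × π ≡ rightFamily q′ d
∈A∣2⇒rightFamily q′ {π} π∈ = from-shape (RightAnalysis.right-shape cy (s≤s (s≤s z≤n)) (proj₂ decoded))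
  where
  decoded = ∈A∣2⁻ (3 + q′) (3 + q′) π∈
  cy = ∈A⇒InA (3 + q′) π (s≤s z≤n) (proj₁ decoded)
  from-shape : (∃ λ dd → ∃ λ u → 3 + q′ ≡ 3 + 0 + dd + u × CycleShape 0 dd u (c π)) → ∃ λ d → d < suc q′ × π ≡ rightFamily q′ d
  from-shape (d , u , n≡ , shape) =
    d , s≤s (subst (d ≤_) (sym q′≡) (m≤m+n d u)) ,
    trans (≡-family 0 d u π (inj₂ refl) (subst (λ m → π ∈ A m) n≡ (proj₁ decoded)) shape) (cong (Family.oneLine 0 d) (sym u≡))
    where
    q′≡ : q′ ≡ d + u
    q′≡ = suc-injective (suc-injective (suc-injective n≡))
    u≡ : q′ ∸ d ≡ u
    u≡ = trans (cong (_∸ d) q′≡) (m+n∸m≡n d u)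

leftFamily∈A⁻∣2 : ∀ n q′ d → 4 + q′ < n → d < suc q′ → leftFamily n q′ d ∈ A⁻∣2 n (4 + q′)
leftFamily∈A⁻∣2 n q′ d r<n d<1+q′ =
  ∈A⁻∣2⁺ n (4 + q′) (subst (λ m → Family.oneLine l (suc d) u ∈ A m) size≡n (family-∈A l (suc d) u valid)) Cr≡2 (<⇒≢ Cq<n)
  where
  l = n ∸ (4 + q′)
  u = q′ ∸ d
  valid : 1 ≤ suc d ⊎ l ≡ 0
  valid = inj₁ (s≤s z≤n)
  open Family l (suc d) u using (size; oneLine; cycleList; cycleList-shape)
  u+d≡q′ : u + d ≡ q′
  u+d≡q′ = m∸n+n≡m (≤-pred d<1+q′)
  size≡n : size ≡ n
  size≡n = trans (arith l d u) (trans (cong (λ x → 4 + x + l) u+d≡q′) (m+[n∸m]≡n (<⇒≤ r<n)))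
    where
    arith : ∀ l d u → 3 + l + suc d + u ≡ 4 + (u + d) + l
    arith = solve-∀
  Cr≡2 : c oneLine (4 + q′) ≡ 2
  Cr≡2 = trans (c-family l (suc d) u valid (4 + q′))
               (trans (cong (app cycleList) (trans (cong (4 +_) (sym u+d≡q′)) (arith u d))) (CycleShape.two cycleList-shape))
    where
    arith : ∀ u d → 4 + (u + d) ≡ 3 + u + suc d
    arith = solve-∀
  Cq≡3+l : c oneLine (3 + q′) ≡ 3 + l
  Cq≡3+l = trans (c-family l (suc d) u valid (3 + q′))
                 (+-cancelʳ-≡ d _ _ (trans (cong (λ i → app cycleList (3 + i) + d) (sym u+d≡q′))
                                           (trans (CycleShape.fall cycleList-shape d ≤-refl) (+-suc (2 + l) d))))
  Cq<n : c oneLine (3 + q′) < n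
  Cq<n = subst₂ _<_ (sym Cq≡3+l) size≡n (≤-trans (m<m+n (3 + l) (s≤s z≤n)) (m≤m+n (3 + l + suc d) u))

rightFamily∈A∣2 : ∀ q′ d → d < suc q′ → rightFamily q′ d ∈ A∣2 (3 + q′) (3 + q′)
rightFamily∈A∣2 q′ d d<1+q′ =
  ∈A∣2⁺ (3 + q′) (3 + q′) (subst (λ m → Family.oneLine 0 d u ∈ A m) (cong (3 +_) d+u≡q′) (family-∈A 0 d u (inj₂ refl))) Cn≡2
  where
  u = q′ ∸ d
  d+u≡q′ : d + u ≡ q′
  d+u≡q′ = m+[n∸m]≡n (≤-pred d<1+q′)
  Cn≡2 : c (Family.oneLine 0 d u) (3 + q′) ≡ 2
  Cn≡2 = trans (c-family 0 d u (inj₂ refl) (3 + q′))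
               (trans (cong (app (Family.cycleList 0 d u)) (cong (3 +_) (trans (sym d+u≡q′) (+-comm d u))))
                      (CycleShape.two (Family.cycleList-shape 0 d u)))

lemma4p6 : ∀ (n r : ℕ) → 3 < r → r < n →
           length (A⁻∣2 n r) ≡ length (A∣2 (r ∸ 1) (r ∸ 1))
lemma4p6 n r 3<r r<n with m≤n⇒∃[o]m+o≡n 3<r
... | q′ , refl = trans
  (length≡-by-parametrisation (leftFamily n q′) (suc q′) (Unique.filter⁺ _ (Unique-A n))
     (λ eq → suc-injective (+-cancelˡ-≡ (3 + (n ∸ (4 + q′))) _ _ (∷-injectiveˡ eq)))
     (∈A⁻∣2⇒leftFamily n q′ r<n) (λ d d< → leftFamily∈A⁻∣2 n q′ d r<n d<))
  (sym (length≡-by-parametrisation (rightFamily q′) (suc q′) (Unique.filter⁺ _ (Unique-A (3 + q′)))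
     (λ eq → +-cancelˡ-≡ 3 _ _ (∷-injectiveˡ eq))
     (∈A∣2⇒rightFamily q′) (rightFamily∈A∣2 q′)))
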